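{- Let $\alpha,\alpha',\beta,\beta',\beta''$ be non-zero integers with $\alpha\beta'-\alpha'\beta\neq0$, and let $$Q_1(\mathbf{x})=\alpha(x_1^2+x_2^2)+\alpha'(x_3^2+x_4^2),\qquad Q_2(\mathbf{x})=\beta(x_1^2+x_2^2)+\beta'(x_3^2+x_4^2)+\beta''(x_5^2+x_6^2).$$ For a positive integer $d$ let $\rho(d)=\#\{\mathbf{k}\in(\mathbb{Z}/d\mathbb{Z})^6: Q_1(\mathbf{k})\equiv Q_2(\mathbf{k})\equiv 0\bmod d\}$. Then for every $\varepsilon>0$ we have $\rho(d)=O(d^{4+\varepsilon})$, the implied constant depending on $\varepsilon$ and $\alpha,\alpha',\beta,\beta',\beta''$. -}

module Defs where

open import Data.Nat as ℕ using (ℕ; zero; suc)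
open import Data.Integer as ℤ using (ℤ; +_; ∣_∣)
open import Data.Integer.Divisibility using (_∣_)
open import Data.Nat.Divisibility using (_∣?_)
open import Data.List using (List; map; upTo)
open import Data.Nat.ListAction using (sum)
open import Data.Bool using (Bool; true; false; _∧_; if_then_else_)
open import Relation.Nullary.Decidable using (⌊_⌋)

Σres : ℕ → (ℕ → ℕ) → ℕ
Σres d f = sum (map f (upTo d))

divides? : ℕ → ℤ → Bool
divides? d z = ⌊ d ∣? ∣ z ∣ ⌋

sq : ℤ → ℤ
sq x = x ℤ.* x

Q₁ : (α α' : ℤ) → (x₁ x₂ x₃ x₄ x₅ x₆ : ℤ) → ℤ
Q₁ α α' x₁ x₂ x₃ x₄ x₅ x₆ = α ℤ.* (sq x₁ ℤ.+ sq x₂) ℤ.+ α' ℤ.* (sq x₃ ℤ.+ sq x₄)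

Q₂ : (β β' β'' : ℤ) → (x₁ x₂ x₃ x₄ x₅ x₆ : ℤ) → ℤ
Q₂ β β' β'' x₁ x₂ x₃ x₄ x₅ x₆ =
  β ℤ.* (sq x₁ ℤ.+ sq x₂) ℤ.+ β' ℤ.* (sq x₃ ℤ.+ sq x₄) ℤ.+ β'' ℤ.* (sq x₅ ℤ.+ sq x₆)

-- ρ(d) = #{ k ∈ (ℤ/dℤ)^6 : Q₁(k) ≡ Q₂(k) ≡ 0 mod d }, counting over residues 0..d-1
ρ : (α α' β β' β'' : ℤ) → ℕ → ℕ
ρ α α' β β' β'' d =
  Σres d λ k₁ → Σres d λ k₂ → Σres d λ k₃ →
  Σres d λ k₄ → Σres d λ k₅ → Σres d λ k₆ →
  if divides? d (Q₁ α α' (+ k₁) (+ k₂) (+ k₃) (+ k₄) (+ k₅) (+ k₆))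
     ∧ divides? d (Q₂ β β' β'' (+ k₁) (+ k₂) (+ k₃) (+ k₄) (+ k₅) (+ k₆))
  then 1 else 0

-- Since β'Q₁ − α'Q₂ = Δ(x₁² + x₂²) − α'β''(x₅² + x₆²) and αQ₂ − βQ₁ = Δ(x₃² + x₄²) + αβ''(x₅² + x₆²),
-- where Δ = αβ' − α'β, ρ(d) is at most the sum over (x₅, x₆) of A(c₁)A(c₂), where A(c) counts the
-- (x, y) mod d with Δ(x² + y²) ≡ c. As Δ ≠ 0, only O(d) integers n < 2d² satisfy Δn ≡ c, and each is
-- x² + y² with 0 ≤ x, y < d in at most τ(n)² + 1 ways; the divisor bound τ(n) = O(n^ε) then gives
-- A(c) = O(d^(1+ε)) and ρ(d) = O(d^(4+ε)). The count of representations rests on sorting them by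
-- g = gcd(x, y): a primitive representation a² + b² = m is determined by gcd(m, ab₀ − a₀b) for any
-- fixed primitive representation a₀² + b₀² = m.

module Submission where

open import Defs
open import Data.Bool using (Bool; true; false; T; _∧_; _∨_; not; if_then_else_)
open import Data.Bool.Properties using (T-∧; T-∨)
open import Data.Empty using (⊥; ⊥-elim)
open import Data.Integer as ℤ using (ℤ; +_; -[1+_]; ∣_∣; 0ℤ)
import Data.Integer.Properties as ℤ
import Data.Integer.Divisibility.Signed as ℤ∣
import Data.Integer.Tactic.RingSolver as ℤ-Ring
open import Data.List using (map; applyUpTo)
open import Data.Nat using (ℕ; zero; suc; _+_; _*_; _^_; _∸_; _/_; _%_; _≤_; _<_; _≤?_; _≟_; _≡ᵇ_;
  z≤n; s≤s; z<s; NonZero; NonTrivial; >-nonZero; >-nonZero⁻¹; ≢-nonZero; ≢-nonZero⁻¹;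
  n>1⇒nonTrivial; nonTrivial⇒n>1)
open import Data.Nat.Coprimality as Coprimality using (Coprime; coprime-divisor; GCD≡1⇒coprime)
open import Data.Nat.Divisibility
open import Data.Nat.DivMod using (m/n*n≡m; m*n/n≡m; n/n≡1; m≡m%n+[m/n]*n; m%n<n; m/n*n≤m; m<n*o⇒m/o<n)
open import Data.Nat.GCD using (gcd; GCD; gcd-GCD; GCD-/; gcd[m,n]∣m; gcd[m,n]∣n; gcd[m,n]≢0; gcd[m,n]≡0⇒m≡0;
  gcd-greatest)
open import Data.Nat.Induction using (<-rec)
open import Data.Nat.ListAction using (sum)
open import Data.Nat.Primality using (Prime; prime; _Rough_; 2-rough; rough⇒≤; ∤⇒rough-suc; rough∧∣⇒rough;
  rough∧∣⇒prime; prime⇒irreducible; prime⇒nonZero; irreducible[2])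
open import Data.Nat.Properties
open import Algebra.Properties.CommutativeSemigroup +-commutativeSemigroup using ()
  renaming (interchange to +-interchange)
open import Algebra.Properties.CommutativeSemigroup *-commutativeSemigroup using ()
  renaming (interchange to *-interchange)
import Data.Nat.Tactic.RingSolver as ℕ-Ring
open import Data.Product using (∃-syntax; _×_; _,_; proj₁; proj₂)
open import Data.Sum using (_⊎_; inj₁; inj₂; [_,_]′)
open import Function using (_∘_; id; it; Equivalence)
open import Relation.Binary.Definitions using (tri<; tri≈; tri>)
open import Relation.Binary.PropositionalEquality
open import Relation.Nullary using (¬_; Dec; yes; no; contradiction)
open import Relation.Nullary.Decidable using (⌊_⌋; toWitness; fromWitness)

-- Elementary arithmetic

^-distribʳ-* : ∀ m n o → (m * n) ^ o ≡ m ^ o * n ^ o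
^-distribʳ-* m n zero    = refl
^-distribʳ-* m n (suc o) = trans (cong (m * n *_) (^-distribʳ-* m n o)) (*-interchange m n (m ^ o) (n ^ o))

1+n≤2^n : ∀ n → suc n ≤ 2 ^ n
1+n≤2^n zero    = ≤-refl
1+n≤2^n (suc n) = +-mono-≤ (m^n>0 2 n) (≤-trans (1+n≤2^n n) (≤-reflexive (sym (+-identityʳ (2 ^ n)))))

[1+a]^k≤k^k*2^a : ∀ k .{{_ : NonZero k}} a → suc a ^ k ≤ k ^ k * 2 ^ a
[1+a]^k≤k^k*2^a k a = begin
  suc a ^ k              ≤⟨ ^-monoˡ-≤ k 1+a≤k*[1+q] ⟩
  (k * suc q) ^ k        ≡⟨ ^-distribʳ-* k (suc q) k ⟩
  k ^ k * suc q ^ k      ≤⟨ *-monoʳ-≤ (k ^ k) (^-monoˡ-≤ k (1+n≤2^n q)) ⟩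
  k ^ k * (2 ^ q) ^ k    ≡⟨ cong (k ^ k *_) (^-*-assoc 2 q k) ⟩
  k ^ k * 2 ^ (q * k)    ≤⟨ *-monoʳ-≤ (k ^ k) (^-monoʳ-≤ 2 (m/n*n≤m a k)) ⟩
  k ^ k * 2 ^ a          ∎
  where
  open ≤-Reasoning
  q = a / k
  1+a≤k*[1+q] : suc a ≤ k * suc q
  1+a≤k*[1+q] = begin
    suc a             ≡⟨ cong suc (m≡m%n+[m/n]*n a k) ⟩
    suc (a % k) + q * k ≤⟨ +-monoˡ-≤ (q * k) (m%n<n a k) ⟩
    k + q * k         ≡⟨ cong (λ s → k + s) (*-comm q k) ⟩
    k + k * q         ≡⟨ *-suc k q ⟨
    k * suc q         ∎

[1+a]^k≤p^a : ∀ k a {p} → 2 ^ k ≤ p → suc a ^ k ≤ p ^ a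
[1+a]^k≤p^a k a {p} 2^k≤p = begin
  suc a ^ k     ≤⟨ ^-monoˡ-≤ k (1+n≤2^n a) ⟩
  (2 ^ a) ^ k   ≡⟨ ^-*-assoc 2 a k ⟩
  2 ^ (a * k)   ≡⟨ cong (2 ^_) (*-comm a k) ⟩
  2 ^ (k * a)   ≡⟨ ^-*-assoc 2 k a ⟨
  (2 ^ k) ^ a   ≤⟨ ^-monoˡ-≤ a 2^k≤p ⟩
  p ^ a         ∎
  where open ≤-Reasoning

m<p^[1+a]*m : ∀ {p} a m .{{_ : NonZero m}} → 2 ≤ p → m < p ^ suc a * m
m<p^[1+a]*m {p} a m 2≤p = begin-strict
  m              ≤⟨ m≤n*m m (p ^ a) {{m^n≢0 p a {{>-nonZero (≤-trans (s≤s z≤n) 2≤p)}}}} ⟩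
  p ^ a * m      <⟨ *-monoˡ-< m (^-monoʳ-< p 2≤p (n<1+n a)) ⟩
  p ^ suc a * m  ∎
  where open ≤-Reasoning

n≤n*n : ∀ n → n ≤ n * n
n≤n*n zero      = z≤n
n≤n*n n@(suc _) = m≤m*n n n

n≤n^[1+m] : ∀ n m → n ≤ n ^ suc m
n≤n^[1+m] zero      m = z≤n
n≤n^[1+m] n@(suc _) m = m≤m*n n (n ^ m) {{m^n≢0 n m}}

m*m≤n*n⇒m≤n : ∀ {m n} → m * m ≤ n * n → m ≤ n
m*m≤n*n⇒m≤n m*m≤n*n = ≮⇒≥ λ n<m → <⇒≱ (*-mono-< n<m n<m) m*m≤n*n

m*m≡n*n⇒m≡n : ∀ {m n} → m * m ≡ n * n → m ≡ n
m*m≡n*n⇒m≡n {m} {n} eq with <-cmp m n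
... | tri< m<n _ _ = contradiction eq (<⇒≢ (*-mono-< m<n m<n))
... | tri≈ _ m≡n _ = m≡n
... | tri> _ _ n<m = contradiction (sym eq) (<⇒≢ (*-mono-< n<m n<m))

∣m+n∣n⇒∣m : ∀ {d m n} → d ∣ m + n → d ∣ n → d ∣ m
∣m+n∣n⇒∣m {d} {m} {n} d∣m+n d∣n = ∣m+n∣m⇒∣n (subst (d ∣_) (+-comm m n) d∣m+n) d∣n

∣<⇒≡0 : ∀ {m n} → m ∣ n → n < m → n ≡ 0
∣<⇒≡0 {n = zero}  _   _   = refl
∣<⇒≡0 {n = suc n} m∣n n<m = contradiction (∣⇒≤ m∣n) (<⇒≱ n<m)

coprime-∣ : ∀ {x m d} → Coprime x m → d ∣ m → Coprime d x
coprime-∣ x⊥m d∣m (c∣d , c∣x) = x⊥m (c∣x , ∣-trans c∣d d∣m)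

coprime⇒*∣ : ∀ {e h t} → Coprime e h → e ∣ t → h ∣ t → e * h ∣ t
coprime⇒*∣ {e} {h} e⊥h (divides-refl k) h∣k*e =
  subst (e * h ∣_) (*-comm e k) (*-monoʳ-∣ e (coprime-divisor (Coprimality.sym e⊥h) (subst (h ∣_) (*-comm k e) h∣k*e)))

coprime-ratio-injective : ∀ {a b a' b'} → Coprime a b → Coprime a' b' → a * b' ≡ a' * b → a ≡ a'
coprime-ratio-injective {a} {b} {a'} {b'} a⊥b a'⊥b' ab'≡a'b = ∣-antisym a∣a' a'∣a
  where
  a∣a' : a ∣ a'
  a∣a' = coprime-divisor a⊥b (divides b' (trans (*-comm b a') (trans (sym ab'≡a'b) (*-comm a b'))))
  a'∣a : a' ∣ a
  a'∣a = coprime-divisor a'⊥b' (divides b (trans (*-comm b' a) (trans ab'≡a'b (*-comm a' b))))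

prime∤⇒coprime : ∀ {p e} → Prime p → ¬ p ∣ e → Coprime p e
prime∤⇒coprime pr p∤e (d∣p , d∣e) with prime⇒irreducible pr d∣p
... | inj₁ d≡1 = d≡1
... | inj₂ refl = contradiction d∣e p∤e

coprime∧∣p^a*m⇒∣m : ∀ {p e} m a → Coprime p e → e ∣ p ^ a * m → e ∣ m
coprime∧∣p^a*m⇒∣m m zero    _  e∣m = subst (_ ∣_) (+-identityʳ m) e∣m
coprime∧∣p^a*m⇒∣m {p} {e} m (suc a) cop e∣ =
  coprime∧∣p^a*m⇒∣m m a cop
    (coprime-divisor (Coprimality.sym cop) (subst (e ∣_) (*-assoc p (p ^ a) m) e∣))

∣*⇒∣cofactor : ∀ {m x y h} .{{_ : NonZero m}} → m ≡ gcd m x * h → m ∣ x * y → h ∣ y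
∣*⇒∣cofactor {m} {x} {y} {h} m≡g*h m∣xy with gcd[m,n]∣n m x
... | divides s x≡s*g = coprime-divisor h⊥s (*-cancelˡ-∣ g (subst₂ _∣_ m≡g*h x*y≡g*[s*y] m∣xy))
  where
  g = gcd m x
  instance
    g≢0 : NonZero g
    g≢0 = ≢-nonZero (gcd[m,n]≢0 m x (inj₁ (≢-nonZero⁻¹ m)))
  x*y≡g*[s*y] : x * y ≡ g * (s * y)
  x*y≡g*[s*y] = trans (cong (_* y) (trans x≡s*g (*-comm s g))) (*-assoc g s y)
  h⊥s : Coprime h s
  h⊥s {d} (d∣h , d∣s) = ∣1⇒≡1 (*-cancelˡ-∣ g (subst (g * d ∣_) (sym (*-identityʳ g)) g*d∣g))
    where
    g*d∣g : g * d ∣ g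
    g*d∣g = gcd-greatest (subst (g * d ∣_) (sym m≡g*h) (*-monoʳ-∣ g d∣h))
                         (subst (g * d ∣_) (sym (trans x≡s*g (*-comm s g))) (*-monoʳ-∣ g d∣s))

∣-linear-combination : ∀ {k} x y c c' → k ∣ ∣ x ∣ → k ∣ ∣ y ∣ → k ∣ ∣ c ℤ.* x ℤ.- c' ℤ.* y ∣
∣-linear-combination {k} x y c c' k∣x k∣y =
  ℤ∣.∣⇒∣ᵤ (ℤ∣.∣m∣n⇒∣m-n (ℤ∣.∣n⇒∣m*n c (ℤ∣.∣ᵤ⇒∣ {+ k} k∣x))
                        (ℤ∣.∣n⇒∣m*n c' (ℤ∣.∣ᵤ⇒∣ {+ k} k∣y)))

+-sumSq : ∀ a b → + (a * a + b * b) ≡ + a ℤ.* + a ℤ.+ + b ℤ.* + b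
+-sumSq a b = trans (ℤ.pos-+ (a * a) (b * b)) (cong₂ ℤ._+_ (ℤ.pos-* a a) (ℤ.pos-* b b))

∣i∣*∣i∣ : ∀ i → + (∣ i ∣ * ∣ i ∣) ≡ i ℤ.* i
∣i∣*∣i∣ (+ n)    = ℤ.pos-* n n
∣i∣*∣i∣ -[1+ n ] = refl

p^a*m-decomposition : ∀ p .{{_ : NonTrivial p}} n → NonZero n → ∃[ a ] ∃[ m ] (n ≡ p ^ a * m × ¬ p ∣ m)
p^a*m-decomposition p = <-rec _ step
  where
  step : ∀ n → (∀ {n'} → n' < n → NonZero n' → ∃[ a ] ∃[ m ] (n' ≡ p ^ a * m × ¬ p ∣ m)) →
         NonZero n → ∃[ a ] ∃[ m ] (n ≡ p ^ a * m × ¬ p ∣ m)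
  step n rec n≢0 with p ∣? n
  ... | no p∤n = 0 , n , sym (+-identityʳ n) , p∤n
  ... | yes p∣n@(divides-refl q)
    with rec (quotient-< p∣n {{it}} {{n≢0}}) (m*n≢0⇒m≢0 q {{n≢0}})
  ...   | a , m , q≡ , p∤m = suc a , m , q*p≡ , p∤m
    where
    q*p≡ : q * p ≡ p * p ^ a * m
    q*p≡ = begin
      q * p           ≡⟨ cong (_* p) q≡ ⟩
      p ^ a * m * p   ≡⟨ *-comm (p ^ a * m) p ⟩
      p * (p ^ a * m) ≡⟨ *-assoc p (p ^ a) m ⟨
      p * p ^ a * m   ∎
      where open ≡-Reasoning

leastPrimeFactor : ∀ n .{{_ : NonTrivial n}} → ∃[ p ] (Prime p × p ∣ n × p Rough n)
leastPrimeFactor n = search n 2 2-rough (m<m+n n z<s)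
  where
  search : ∀ k j .{{_ : NonTrivial j}} → j Rough n → n < k + j → ∃[ p ] (Prime p × p ∣ n × p Rough n)
  search k j rough n<k+j with j ∣? n
  search k       j rough n<k+j | yes j∣n = j , rough∧∣⇒prime rough j∣n , j∣n , rough
  search zero    j rough n<j   | no _    = contradiction (rough⇒≤ rough) (<⇒≱ n<j)
  search (suc k) j rough n<k+j | no j∤n  =
    search k (suc j) {{n>1⇒nonTrivial (m<n⇒m<1+n (nonTrivial⇒n>1 j))}} (∤⇒rough-suc j∤n rough)
      (subst (n <_) (sym (+-suc k j)) n<k+j)

-- Finite sums and counting

∑ : ℕ → (ℕ → ℕ) → ℕ
∑ zero    f = 0
∑ (suc n) f = ∑ n f + f n

syntax ∑ n (λ x → f) = ∑[ x < n ] f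

∑-suc : ∀ n f → ∑ (suc n) f ≡ f 0 + ∑ n (f ∘ suc)
∑-suc zero    f = sym (+-identityʳ (f 0))
∑-suc (suc n) f = trans (cong (_+ f (suc n)) (∑-suc n f)) (+-assoc (f 0) _ _)

sum-applyUpTo : ∀ n (g f : ℕ → ℕ) → sum (map f (applyUpTo g n)) ≡ ∑ n (f ∘ g)
sum-applyUpTo zero    g f = refl
sum-applyUpTo (suc n) g f =
  trans (cong (λ s → f (g 0) + s) (sum-applyUpTo n (g ∘ suc) f)) (sym (∑-suc n (f ∘ g)))

Σres≡∑ : ∀ n f → Σres n f ≡ ∑ n f
Σres≡∑ n f = sum-applyUpTo n (λ x → x) f

∑-cong : ∀ n {f g : ℕ → ℕ} → (∀ x → x < n → f x ≡ g x) → ∑ n f ≡ ∑ n g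
∑-cong zero    _ = refl
∑-cong (suc n) h = cong₂ _+_ (∑-cong n (λ x x<n → h x (m<n⇒m<1+n x<n))) (h n ≤-refl)

∑-mono-≤ : ∀ n {f g : ℕ → ℕ} → (∀ x → x < n → f x ≤ g x) → ∑ n f ≤ ∑ n g
∑-mono-≤ zero    _ = z≤n
∑-mono-≤ (suc n) h = +-mono-≤ (∑-mono-≤ n (λ x x<n → h x (m<n⇒m<1+n x<n))) (h n ≤-refl)

∑-≤-* : ∀ n {f : ℕ → ℕ} c → (∀ x → x < n → f x ≤ c) → ∑ n f ≤ n * c
∑-≤-* zero    c _ = z≤n
∑-≤-* (suc n) c h = begin
  ∑ n _ + _ ≤⟨ +-mono-≤ (∑-≤-* n c (λ x x<n → h x (m<n⇒m<1+n x<n))) (h n ≤-refl) ⟩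
  n * c + c ≡⟨ +-comm (n * c) c ⟩
  suc n * c ∎
  where open ≤-Reasoning

∑-distrib-+ : ∀ n (f g : ℕ → ℕ) → ∑[ x < n ] (f x + g x) ≡ ∑ n f + ∑ n g
∑-distrib-+ zero    f g = refl
∑-distrib-+ (suc n) f g = trans (cong (_+ (f n + g n)) (∑-distrib-+ n f g)) (+-interchange (∑ n f) (∑ n g) (f n) (g n))

∑-*ˡ : ∀ n c (f : ℕ → ℕ) → ∑[ x < n ] (c * f x) ≡ c * ∑ n f
∑-*ˡ zero    c f = sym (*-zeroʳ c)
∑-*ˡ (suc n) c f = trans (cong (_+ c * f n) (∑-*ˡ n c f)) (sym (*-distribˡ-+ c (∑ n f) (f n)))

∑-*ʳ : ∀ n c (f : ℕ → ℕ) → ∑[ x < n ] (f x * c) ≡ ∑ n f * c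
∑-*ʳ n c f = trans (∑-cong n (λ x _ → *-comm (f x) c)) (trans (∑-*ˡ n c f) (*-comm c (∑ n f)))

∑-zero : ∀ n {f : ℕ → ℕ} → (∀ x → x < n → f x ≡ 0) → ∑ n f ≡ 0
∑-zero zero    _ = refl
∑-zero (suc n) h = cong₂ _+_ (∑-zero n (λ x x<n → h x (m<n⇒m<1+n x<n))) (h n ≤-refl)

∑-comm : ∀ m n (f : ℕ → ℕ → ℕ) → ∑[ x < m ] ∑[ y < n ] f x y ≡ ∑[ y < n ] ∑[ x < m ] f x y
∑-comm zero    n f = sym (∑-zero n (λ _ _ → refl))
∑-comm (suc m) n f = trans (cong (_+ ∑ n (f m)) (∑-comm m n f))
                           (sym (∑-distrib-+ n (λ y → ∑[ x < m ] f x y) (f m)))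

term≤∑ : ∀ n (f : ℕ → ℕ) {x} → x < n → f x ≤ ∑ n f
term≤∑ (suc n) f {x} x<1+n with m<1+n⇒m<n∨m≡n x<1+n
... | inj₁ x<n  = ≤-trans (term≤∑ n f x<n) (m≤m+n _ _)
... | inj₂ refl = m≤n+m _ _

𝟙 : Bool → ℕ
𝟙 b = if b then 1 else 0

count : ℕ → (ℕ → Bool) → ℕ
count n P = ∑[ x < n ] 𝟙 (P x)

T-∧⁻ : ∀ {a b} → T (a ∧ b) → T a × T b
T-∧⁻ = Equivalence.to T-∧

𝟙-∧ : ∀ a b → 𝟙 (a ∧ b) ≡ 𝟙 a * 𝟙 b
𝟙-∧ true  b = sym (+-identityʳ (𝟙 b))
𝟙-∧ false b = refl

T⇒𝟙≡1 : ∀ {b} → T b → 𝟙 b ≡ 1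
T⇒𝟙≡1 {true} _ = refl

𝟙-mono-≤ : ∀ {a b} → (T a → T b) → 𝟙 a ≤ 𝟙 b
𝟙-mono-≤ {false} _   = z≤n
𝟙-mono-≤ {true}  a⇒b = ≤-reflexive (sym (T⇒𝟙≡1 (a⇒b _)))

count-mono-≤ : ∀ n {P Q : ℕ → Bool} → (∀ {x} → x < n → T (P x) → T (Q x)) → count n P ≤ count n Q
count-mono-≤ n P⇒Q = ∑-mono-≤ n (λ x x<n → 𝟙-mono-≤ (P⇒Q x<n))

count-≡0 : ∀ n {P : ℕ → Bool} → (∀ {x} → x < n → T (P x) → ⊥) → count n P ≡ 0
count-≡0 n {P} none = ∑-zero n pointwise
  where
  pointwise : ∀ x → x < n → 𝟙 (P x) ≡ 0
  pointwise x x<n with P x | none {x} x<n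
  ... | false | _ = refl
  ... | true  | f = ⊥-elim (f _)

count>0⇒∃ : ∀ n (P : ℕ → Bool) → 0 < count n P → ∃[ x ] (x < n × T (P x))
count>0⇒∃ (suc n) P pos with P n in eq
... | true  = n , ≤-refl , subst T (sym eq) _
... | false with count>0⇒∃ n P (≤-trans pos (≤-reflexive (+-identityʳ _)))
...   | x , x<n , px = x , m<n⇒m<1+n x<n , px

count-≤-from-member : ∀ n (P : ℕ → Bool) {k} →
  (∀ {x} → x < n → T (P x) → count n P ≤ k) → count n P ≤ k
count-≤-from-member n P bound with count n P in eq
... | zero  = z≤n
... | suc c with count>0⇒∃ n P (subst (0 <_) (sym eq) z<s)
...   | x , x<n , px = bound x<n px

count-≤-𝟙 : ∀ n (P : ℕ → Bool) q →
  (∀ {x y} → x < n → y < n → T (P x) → T (P y) → x ≡ y) →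
  (∀ {x} → x < n → T (P x) → T q) → count n P ≤ 𝟙 q
count-≤-𝟙 zero    P q _      _     = z≤n
count-≤-𝟙 (suc n) P q unique ⇒q with P n in eq
... | false = ≤-trans (≤-reflexive (+-identityʳ _))
                      (count-≤-𝟙 n P q (λ x<n y<n → unique (m<n⇒m<1+n x<n) (m<n⇒m<1+n y<n))
                                       (λ x<n → ⇒q (m<n⇒m<1+n x<n)))
... | true  = begin
  count n P + 1 ≡⟨ cong (_+ 1) (count-≡0 n none) ⟩
  1             ≡⟨ T⇒𝟙≡1 (⇒q ≤-refl Pn) ⟨
  𝟙 q           ∎
  where
  open ≤-Reasoning
  Pn : T (P n)
  Pn = subst T (sym eq) _
  none : ∀ {x} → x < n → T (P x) → ⊥
  none x<n px = <-irrefl (unique (m<n⇒m<1+n x<n) ≤-refl px Pn) x<n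

count-≤-1 : ∀ n (P : ℕ → Bool) →
  (∀ {x y} → x < n → y < n → T (P x) → T (P y) → x ≡ y) → count n P ≤ 1
count-≤-1 n P unique = count-≤-𝟙 n P true unique _

count-≤-fibres : ∀ m n (P : ℕ → Bool) (f : ℕ → ℕ) → (∀ {x} → x < m → T (P x) → f x < n) →
  count m P ≤ ∑[ y < n ] count m (λ x → P x ∧ (f x ≡ᵇ y))
count-≤-fibres m n P f f<n = begin
  count m P                                   ≤⟨ ∑-mono-≤ m pointwise ⟩
  ∑[ x < m ] ∑[ y < n ] 𝟙 (P x ∧ (f x ≡ᵇ y))  ≡⟨ ∑-comm m n _ ⟩
  ∑[ y < n ] count m (λ x → P x ∧ (f x ≡ᵇ y)) ∎
  where
  open ≤-Reasoning
  pointwise : ∀ x → x < m → 𝟙 (P x) ≤ ∑[ y < n ] 𝟙 (P x ∧ (f x ≡ᵇ y))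
  pointwise x x<m with P x | f<n {x} x<m
  ... | false | _   = z≤n
  ... | true  | fx< = subst (_≤ ∑[ y < n ] 𝟙 (f x ≡ᵇ y)) (T⇒𝟙≡1 (≡⇒≡ᵇ (f x) (f x) refl))
                            (term≤∑ n (λ y → 𝟙 (f x ≡ᵇ y)) (fx< _))

count-≤-injective : ∀ m n (P Q : ℕ → Bool) (f : ℕ → ℕ) →
  (∀ {x} → x < m → T (P x) → f x < n × T (Q (f x))) →
  (∀ {x y} → x < m → y < m → T (P x) → T (P y) → f x ≡ f y → x ≡ y) →
  count m P ≤ count n Q
count-≤-injective m n P Q f maps injective = begin
  count m P                                   ≤⟨ count-≤-fibres m n P f (λ x<m px → proj₁ (maps x<m px)) ⟩
  ∑[ y < n ] count m (λ x → P x ∧ (f x ≡ᵇ y)) ≤⟨ ∑-mono-≤ n fibre ⟩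
  count n Q ∎
  where
  open ≤-Reasoning
  fibre : ∀ y → y < n → count m (λ x → P x ∧ (f x ≡ᵇ y)) ≤ 𝟙 (Q y)
  fibre y _ = count-≤-𝟙 m _ (Q y)
    (λ x<m x'<m hx hx' → injective x<m x'<m (proj₁ (T-∧⁻ hx)) (proj₁ (T-∧⁻ hx'))
                           (trans (at hx) (sym (at hx'))))
    (λ x<m hx → subst (T ∘ Q) (at hx) (proj₂ (maps x<m (proj₁ (T-∧⁻ hx)))))
    where
    at : ∀ {x} → T (P x ∧ (f x ≡ᵇ y)) → f x ≡ y
    at hx = ≡ᵇ⇒≡ _ _ (proj₂ (T-∧⁻ hx))

count-split : ∀ n (P Q : ℕ → Bool) →
  count n P ≡ count n (λ x → P x ∧ not (Q x)) + count n (λ x → P x ∧ Q x)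
count-split n P Q = trans (∑-cong n pointwise) (∑-distrib-+ n _ _)
  where
  pointwise : ∀ x → x < n → 𝟙 (P x) ≡ 𝟙 (P x ∧ not (Q x)) + 𝟙 (P x ∧ Q x)
  pointwise x _ with P x | Q x
  ... | false | _     = refl
  ... | true  | false = refl
  ... | true  | true  = refl

count-∨-≤ : ∀ n (P Q : ℕ → Bool) → count n (λ x → P x ∨ Q x) ≤ count n P + count n Q
count-∨-≤ n P Q = ≤-trans (∑-mono-≤ n pointwise) (≤-reflexive (∑-distrib-+ n _ _))
  where
  pointwise : ∀ x → x < n → 𝟙 (P x ∨ Q x) ≤ 𝟙 (P x) + 𝟙 (Q x)
  pointwise x _ with P x | Q x
  ... | false | false = z≤n
  ... | false | true  = ≤-refl
  ... | true  | _     = s≤s z≤n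

∑-pull₂ : ∀ m n (f : ℕ → ℕ → ℕ → ℕ) →
  ∑[ x < m ] ∑[ z < n ] ∑[ w < n ] f x z w ≡ ∑[ z < n ] ∑[ w < n ] ∑[ x < m ] f x z w
∑-pull₂ m n f = trans (∑-comm m n (λ x z → ∑[ w < n ] f x z w))
                      (∑-cong n (λ z _ → ∑-comm m n (λ x w → f x z w)))

∑-swap₂ : ∀ m n (f : ℕ → ℕ → ℕ → ℕ → ℕ) →
  ∑[ x < m ] ∑[ y < m ] ∑[ z < n ] ∑[ w < n ] f x y z w ≡ ∑[ z < n ] ∑[ w < n ] ∑[ x < m ] ∑[ y < m ] f x y z w
∑-swap₂ m n f = trans (∑-cong m (λ x _ → ∑-pull₂ m n (f x)))
                      (∑-pull₂ m n (λ x z w → ∑[ y < m ] f x y z w))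

∑₂-product : ∀ n (f g : ℕ → ℕ → ℕ) →
  ∑[ x < n ] ∑[ y < n ] ∑[ z < n ] ∑[ w < n ] (f x y * g z w)
    ≡ (∑[ x < n ] ∑[ y < n ] f x y) * (∑[ z < n ] ∑[ w < n ] g z w)
∑₂-product n f g = begin
  ∑[ x < n ] ∑[ y < n ] ∑[ z < n ] ∑[ w < n ] (f x y * g z w)
    ≡⟨ ∑-cong n (λ x _ → ∑-cong n (λ y _ → trans (∑-cong n (λ z _ → ∑-*ˡ n (f x y) (g z))) (∑-*ˡ n (f x y) _))) ⟩
  ∑[ x < n ] ∑[ y < n ] (f x y * G)
    ≡⟨ trans (∑-cong n (λ x _ → ∑-*ʳ n G (f x))) (∑-*ʳ n G _) ⟩
  (∑[ x < n ] ∑[ y < n ] f x y) * G ∎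
  where
  open ≡-Reasoning
  G = ∑[ z < n ] ∑[ w < n ] g z w

argmax : ∀ N (f : ℕ → ℕ) → 0 < N → ∃[ m ] (m < N × ∀ {n} → n < N → f n ≤ f m)
argmax (suc zero)    f _ = 0 , z<s , λ { (s≤s z≤n) → ≤-refl }
argmax (suc (suc N)) f _ with argmax (suc N) f z<s
... | m , m<N , max with f m ≤? f (suc N)
...   | yes fm≤ = suc N , ≤-refl , λ n<N → case n<N fm≤
  where
  case : ∀ {n} → n < suc (suc N) → f m ≤ f (suc N) → f n ≤ f (suc N)
  case n<2+N fm≤ with m<1+n⇒m<n∨m≡n n<2+N
  ... | inj₁ n<1+N = ≤-trans (max n<1+N) fm≤
  ... | inj₂ refl  = ≤-refl
...   | no fm≰ = m , m<n⇒m<1+n m<N , λ n<N → case n<N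
  where
  case : ∀ {n} → n < suc (suc N) → f n ≤ f m
  case n<2+N with m<1+n⇒m<n∨m≡n n<2+N
  ... | inj₁ n<1+N = max n<1+N
  ... | inj₂ refl  = <⇒≤ (≰⇒> fm≰)

-- The divisor function

-- Divisors are counted among 0, …, n, so τ 0 = 1.
τ : ℕ → ℕ
τ n = count (suc n) (λ e → ⌊ e ∣? n ⌋)

1≤τ : ∀ n → 1 ≤ τ n
1≤τ n = ≤-trans (≤-reflexive (sym (T⇒𝟙≡1 (fromWitness (∣-refl {n})))))
                (term≤∑ (suc n) (λ e → 𝟙 ⌊ e ∣? n ⌋) ≤-refl)

count-≤-τ : ∀ A m .{{_ : NonZero m}} (P : ℕ → Bool) (f : ℕ → ℕ) →
  (∀ {x} → x < A → T (P x) → f x ∣ m) →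
  (∀ {x y} → x < A → y < A → T (P x) → T (P y) → f x ≡ f y → x ≡ y) →
  count A P ≤ τ m
count-≤-τ A m P f divides-m injective =
  count-≤-injective A (suc m) P (λ e → ⌊ e ∣? m ⌋) f
    (λ x<A px → s≤s (∣⇒≤ (divides-m x<A px)) , fromWitness (divides-m x<A px)) injective

τ-*-≤ : ∀ p m M .{{_ : NonZero p}} .{{_ : NonZero m}} .{{_ : NonZero M}} →
  (∀ {e} → e ∣ p * M → ¬ p ∣ e → e ∣ m) → τ (p * M) ≤ τ m + τ M
τ-*-≤ p m M coprime-part = begin
  τ N                                  ≡⟨ count-split (suc N) (λ e → ⌊ e ∣? N ⌋) (λ e → ⌊ p ∣? e ⌋) ⟩
  count (suc N) prime-to-p + count (suc N) multiple-of-p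
    ≤⟨ +-mono-≤ (count-≤-τ (suc N) m prime-to-p id prime-to-p⇒∣m (λ _ _ _ _ eq → eq))
                (count-≤-τ (suc N) M multiple-of-p (_/ p) /p∣M /p-injective) ⟩
  τ m + τ M ∎
  where
  open ≤-Reasoning
  N = p * M
  prime-to-p multiple-of-p : ℕ → Bool
  prime-to-p    e = ⌊ e ∣? N ⌋ ∧ not ⌊ p ∣? e ⌋
  multiple-of-p e = ⌊ e ∣? N ⌋ ∧ ⌊ p ∣? e ⌋
  prime-to-p⇒∣m : ∀ {e} → e < suc N → T (prime-to-p e) → e ∣ m
  prime-to-p⇒∣m {e} _ h with e ∣? N | p ∣? e
  ... | yes e∣N | no p∤e = coprime-part e∣N p∤e
  /p∣M : ∀ {e} → e < suc N → T (multiple-of-p e) → e / p ∣ M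
  /p∣M {e} _ h with e ∣? N | p ∣? e
  ... | yes e∣N | yes (divides-refl k) =
    subst (_∣ M) (sym (m*n/n≡m k p)) (*-cancelˡ-∣ p (subst (_∣ N) (*-comm k p) e∣N))
  /p-injective : ∀ {e e'} → e < suc N → e' < suc N → T (multiple-of-p e) → T (multiple-of-p e') →
                 e / p ≡ e' / p → e ≡ e'
  /p-injective {e} {e'} _ _ h h' eq with e ∣? N | p ∣? e | e' ∣? N | p ∣? e'
  ... | yes _ | yes p∣e | yes _ | yes p∣e' =
    trans (sym (m/n*n≡m p∣e)) (trans (cong (_* p) eq) (m/n*n≡m p∣e'))

τ-p^a*m≤ : ∀ {p m} a → Prime p → ¬ p ∣ m → .{{_ : NonZero m}} → τ (p ^ a * m) ≤ suc a * τ m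
τ-p^a*m≤ {p} {m} zero    _  _   = ≤-reflexive (trans (cong τ (+-identityʳ m)) (sym (+-identityʳ (τ m))))
τ-p^a*m≤ {p} {m} (suc a) pr p∤m = begin
  τ (p * p ^ a * m)      ≡⟨ cong τ (*-assoc p (p ^ a) m) ⟩
  τ (p * (p ^ a * m))    ≤⟨ τ-*-≤ p m (p ^ a * m) ∣m ⟩
  τ m + τ (p ^ a * m)    ≤⟨ +-monoʳ-≤ (τ m) (τ-p^a*m≤ a pr p∤m) ⟩
  τ m + suc a * τ m ∎
  where
  open ≤-Reasoning
  instance
    p≢0 : NonZero p
    p≢0 = prime⇒nonZero pr
    p^a*m≢0 : NonZero (p ^ a * m)
    p^a*m≢0 = m*n≢0 (p ^ a) m {{m^n≢0 p a}}
  ∣m : ∀ {e} → e ∣ p * (p ^ a * m) → ¬ p ∣ e → e ∣ m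
  ∣m {e} e∣ p∤e = coprime∧∣p^a*m⇒∣m m (suc a) (prime∤⇒coprime pr p∤e)
                    (subst (e ∣_) (sym (*-assoc p (p ^ a) m)) e∣)

-- A prime factor p^a of n costs a factor (1+a)^K in τ(n)^K; for p ≥ 2^K it is paid for by p^a,
-- and each of the fewer than 2^K smaller primes costs at most K^K more.
module DivisorBound (k : ℕ) where

  K D M : ℕ
  K = suc k
  D = K ^ K
  M = 2 ^ K

  instance
    D≢0 : NonZero D
    D≢0 = m^n≢0 K K

  prime-power-cost : ∀ a p j → 2 ≤ p → j ≤ p → suc a ^ K * D ^ (M ∸ suc p) ≤ D ^ (M ∸ j) * p ^ a
  prime-power-cost a p j 2≤p j≤p with M ≤? p
  ... | yes M≤p = begin
    suc a ^ K * D ^ (M ∸ suc p) ≡⟨ cong (λ e → suc a ^ K * D ^ e) (m≤n⇒m∸n≡0 (m≤n⇒m≤1+n M≤p)) ⟩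
    suc a ^ K * 1               ≡⟨ *-identityʳ _ ⟩
    suc a ^ K                   ≤⟨ [1+a]^k≤p^a K a M≤p ⟩
    p ^ a                       ≤⟨ m≤n*m (p ^ a) (D ^ (M ∸ j)) {{m^n≢0 D (M ∸ j)}} ⟩
    D ^ (M ∸ j) * p ^ a         ∎
    where open ≤-Reasoning
  ... | no M≰p = begin
    suc a ^ K * D ^ (M ∸ suc p)   ≤⟨ *-monoˡ-≤ (D ^ (M ∸ suc p)) [1+a]^K≤D*p^a ⟩
    D * p ^ a * D ^ (M ∸ suc p)   ≡⟨ rearrange D (p ^ a) (D ^ (M ∸ suc p)) ⟩
    D ^ suc (M ∸ suc p) * p ^ a   ≡⟨ cong (λ e → D ^ e * p ^ a) (+-∸-assoc 1 (≰⇒> M≰p)) ⟨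
    D ^ (M ∸ p) * p ^ a           ≤⟨ *-monoˡ-≤ (p ^ a) (^-monoʳ-≤ D (∸-monoʳ-≤ M j≤p)) ⟩
    D ^ (M ∸ j) * p ^ a           ∎
    where
    open ≤-Reasoning
    rearrange : ∀ x y z → x * y * z ≡ x * z * y
    rearrange = ℕ-Ring.solve-∀
    [1+a]^K≤D*p^a : suc a ^ K ≤ D * p ^ a
    [1+a]^K≤D*p^a = ≤-trans ([1+a]^k≤k^k*2^a K a) (*-monoʳ-≤ D (^-monoˡ-≤ a 2≤p))

  τ^K≤ : ∀ n j → NonZero n → j Rough n → τ n ^ K ≤ D ^ (M ∸ j) * n
  τ^K≤ = <-rec _ step
    where
    step : ∀ n → (∀ {m} → m < n → ∀ j → NonZero m → j Rough m → τ m ^ K ≤ D ^ (M ∸ j) * m) →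
           ∀ j → NonZero n → j Rough n → τ n ^ K ≤ D ^ (M ∸ j) * n
    step 1 _ j _ _ = begin
      τ 1 ^ K         ≡⟨ ^-zeroˡ K ⟩
      1               ≤⟨ m^n>0 D (M ∸ j) ⟩
      D ^ (M ∸ j)     ≡⟨ *-identityʳ _ ⟨
      D ^ (M ∸ j) * 1 ∎
      where open ≤-Reasoning
    step n@(suc (suc _)) rec j n≢0 j-rough
      with leastPrimeFactor n
    ... | p , p-prime@(prime {{p-nontrivial}} _) , p∣n , p-rough
      with p^a*m-decomposition p n n≢0
    ... | zero , m , n≡m , p∤m = contradiction (subst (p ∣_) (trans n≡m (*-identityˡ m)) p∣n) p∤m
    ... | a@(suc a') , m , n≡p^a*m , p∤m = begin
      τ n ^ K                           ≤⟨ ^-monoˡ-≤ K (subst (λ x → τ x ≤ suc a * τ m) (sym n≡p^a*m)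
                                              (τ-p^a*m≤ a p-prime p∤m {{m≢0}})) ⟩
      (suc a * τ m) ^ K                 ≡⟨ ^-distribʳ-* (suc a) (τ m) K ⟩
      suc a ^ K * τ m ^ K               ≤⟨ *-monoʳ-≤ (suc a ^ K) (rec m<n (suc p) m≢0 m-rough) ⟩
      suc a ^ K * (D ^ (M ∸ suc p) * m) ≡⟨ *-assoc (suc a ^ K) _ m ⟨
      suc a ^ K * D ^ (M ∸ suc p) * m   ≤⟨ *-monoˡ-≤ m (prime-power-cost a p j 2≤p j≤p) ⟩
      D ^ (M ∸ j) * p ^ a * m           ≡⟨ trans (*-assoc (D ^ (M ∸ j)) (p ^ a) m) (cong (D ^ (M ∸ j) *_) (sym n≡p^a*m)) ⟩
      D ^ (M ∸ j) * n                   ∎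
      where
      open ≤-Reasoning
      instance
        p≢0 : NonZero p
        p≢0 = prime⇒nonZero p-prime
      2≤p : 2 ≤ p
      2≤p = nonTrivial⇒n>1 p
      j≤p : j ≤ p
      j≤p = rough⇒≤ (rough∧∣⇒rough j-rough p∣n)
      m≢0 : NonZero m
      m≢0 = m*n≢0⇒n≢0 (p ^ a) {{subst NonZero n≡p^a*m n≢0}}
      m-rough : suc p Rough m
      m-rough = ∤⇒rough-suc p∤m (rough∧∣⇒rough p-rough (divides (p ^ a) n≡p^a*m))
      m<n : m < n
      m<n = subst (m <_) (sym n≡p^a*m) (m<p^[1+a]*m a' m {{m≢0}} 2≤p)

divisor-bound : ∀ k → ∃[ C ] (∀ n → τ n ^ k ≤ C * suc n)
divisor-bound k = D ^ (M ∸ 2) , bound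
  where
  open DivisorBound k
  bound : ∀ n → τ n ^ k ≤ D ^ (M ∸ 2) * suc n
  bound zero    = ≤-trans (≤-reflexive (^-zeroˡ k)) (≤-trans (m^n>0 D (M ∸ 2)) (m≤m*n _ 1))
  bound (suc n) = begin
    τ (suc n) ^ k           ≤⟨ ^-monoʳ-≤ (τ (suc n)) {{>-nonZero (1≤τ (suc n))}} (n≤1+n k) ⟩
    τ (suc n) ^ K           ≤⟨ τ^K≤ (suc n) 2 _ 2-rough ⟩
    D ^ (M ∸ 2) * suc n     ≤⟨ *-monoʳ-≤ (D ^ (M ∸ 2)) (n≤1+n (suc n)) ⟩
    D ^ (M ∸ 2) * suc (suc n) ∎
    where open ≤-Reasoning

-- Sums of two squares

coprime-sumSq : ∀ {a b} → Coprime a b → Coprime b (a * a + b * b)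
coprime-sumSq {a} {b} cop {d} (d∣b , d∣m) = cop (coprime-divisor d⊥a d∣a*a , d∣b)
  where
  d⊥a : Coprime d a
  d⊥a (c∣d , c∣a) = cop (c∣a , ∣-trans c∣d d∣b)
  d∣a*a : d ∣ a * a
  d∣a*a = ∣m+n∣n⇒∣m d∣m (∣m⇒∣m*n b d∣b)

4∣sumSq⇒even : ∀ a b → 4 ∣ a * a + b * b → (2 ∣ a) × (2 ∣ b)
4∣sumSq⇒even a b 4∣a²+b² with residues (a % 2) (b % 2) (m%n<n a 2) (m%n<n b 2) 4∣i²+j²
  where
  residues : ∀ i j → i < 2 → j < 2 → 4 ∣ i * i + j * j → i ≡ 0 × j ≡ 0
  residues 0 0 _ _ _ = refl , refl
  residues 0 1 _ _ 4∣1 = contradiction 4∣1 (>⇒∤ (s≤s (s≤s z≤n)))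
  residues 1 0 _ _ 4∣1 = contradiction 4∣1 (>⇒∤ (s≤s (s≤s z≤n)))
  residues 1 1 _ _ 4∣2 = contradiction 4∣2 (>⇒∤ (s≤s (s≤s (s≤s z≤n))))
  residues (suc (suc _)) _ (s≤s (s≤s ())) _ _
  residues _ (suc (suc _)) _ (s≤s (s≤s ())) _
  expand : ∀ i j p q → (i + p * 2) * (i + p * 2) + (j + q * 2) * (j + q * 2)
                     ≡ (i * i + j * j) + 4 * (p * i + p * p + q * j + q * q)
  expand = ℕ-Ring.solve-∀
  4∣i²+j² : 4 ∣ a % 2 * (a % 2) + b % 2 * (b % 2)
  4∣i²+j² = ∣m+n∣n⇒∣m (subst (4 ∣_) (trans (cong₂ (λ x y → x * x + y * y) (m≡m%n+[m/n]*n a 2) (m≡m%n+[m/n]*n b 2))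
                                               (expand (a % 2) (b % 2) (a / 2) (b / 2))) 4∣a²+b²)
                      (m∣m*n (a / 2 * (a % 2) + a / 2 * (a / 2) + b / 2 * (b % 2) + b / 2 * (b / 2)))
... | a%2≡0 , b%2≡0 = m%n≡0⇒n∣m a 2 a%2≡0 , m%n≡0⇒n∣m b 2 b%2≡0

-- By Lagrange's identity (ab' − a'b)² + (aa' + bb')² = (a² + b²)(a'² + b'²) = m², and aa' + bb' > 0.
∣ab'-a'b∣<m : ∀ {m a b a' b'} → a * a + b * b ≡ m → a' * a' + b' * b' ≡ m → 0 < a → 0 < a' →
              ∣ + a ℤ.* + b' ℤ.- + a' ℤ.* + b ∣ < m
∣ab'-a'b∣<m {m} {a} {b} {a'} {b'} rep rep' 0<a 0<a' =
  ≰⇒> λ m≤∣t∣ → <⇒≱ ∣t∣²<m² (*-mono-≤ m≤∣t∣ m≤∣t∣)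
  where
  t = + a ℤ.* + b' ℤ.- + a' ℤ.* + b
  u = a * a' + b * b'
  lagrange : ∀ a b a' b' → (a ℤ.* b' ℤ.- a' ℤ.* b) ℤ.* (a ℤ.* b' ℤ.- a' ℤ.* b)
                         ℤ.+ (a ℤ.* a' ℤ.+ b ℤ.* b') ℤ.* (a ℤ.* a' ℤ.+ b ℤ.* b')
                         ≡ (a ℤ.* a ℤ.+ b ℤ.* b) ℤ.* (a' ℤ.* a' ℤ.+ b' ℤ.* b')
  lagrange = ℤ-Ring.solve-∀
  +u : + u ≡ + a ℤ.* + a' ℤ.+ + b ℤ.* + b'
  +u = trans (ℤ.pos-+ (a * a') (b * b')) (cong₂ ℤ._+_ (ℤ.pos-* a a') (ℤ.pos-* b b'))
  ∣t∣²+u²≡m² : ∣ t ∣ * ∣ t ∣ + u * u ≡ m * m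
  ∣t∣²+u²≡m² = ℤ.+-injective (begin
    + (∣ t ∣ * ∣ t ∣ + u * u)              ≡⟨ ℤ.pos-+ (∣ t ∣ * ∣ t ∣) (u * u) ⟩
    + (∣ t ∣ * ∣ t ∣) ℤ.+ + (u * u)        ≡⟨ cong₂ ℤ._+_ (∣i∣*∣i∣ t) (trans (ℤ.pos-* u u) (cong₂ ℤ._*_ +u +u)) ⟩
    t ℤ.* t ℤ.+ (+ a ℤ.* + a' ℤ.+ + b ℤ.* + b') ℤ.* (+ a ℤ.* + a' ℤ.+ + b ℤ.* + b')
                                           ≡⟨ lagrange (+ a) (+ b) (+ a') (+ b') ⟩
    (+ a ℤ.* + a ℤ.+ + b ℤ.* + b) ℤ.* (+ a' ℤ.* + a' ℤ.+ + b' ℤ.* + b')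
                                           ≡⟨ cong₂ ℤ._*_ (trans (sym (+-sumSq a b)) (cong +_ rep))
                                                          (trans (sym (+-sumSq a' b')) (cong +_ rep')) ⟩
    + m ℤ.* + m                            ≡⟨ ℤ.pos-* m m ⟨
    + (m * m)                              ∎)
    where open ≡-Reasoning
  u>0 : 0 < u
  u>0 = ≤-trans (*-mono-≤ 0<a 0<a') (m≤m+n (a * a') (b * b'))
  ∣t∣²<m² : ∣ t ∣ * ∣ t ∣ < m * m
  ∣t∣²<m² = subst (∣ t ∣ * ∣ t ∣ <_) ∣t∣²+u²≡m²
              (m<m+n (∣ t ∣ * ∣ t ∣) (*-mono-≤ u>0 u>0))

module PrimitiveRepresentations {m a₀ b₀ : ℕ} (rep₀ : a₀ * a₀ + b₀ * b₀ ≡ m) (a₀⊥b₀ : Coprime a₀ b₀) where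

  det perm : ℕ → ℕ → ℤ
  det  a b = + a ℤ.* + b₀ ℤ.- + a₀ ℤ.* + b
  perm a b = + a ℤ.* + b₀ ℤ.+ + a₀ ℤ.* + b

  m∣det*perm : ∀ {a b} → a * a + b * b ≡ m → m ∣ ∣ det a b ∣ * ∣ perm a b ∣
  m∣det*perm {a} {b} rep =
    subst (m ∣_) (ℤ.abs-* (det a b) (perm a b))
      (ℤ∣.∣⇒∣ᵤ (ℤ∣.divides (+ a ℤ.* + a ℤ.- + a₀ ℤ.* + a₀) det*perm≡))
    where
    expand : ∀ a b a₀ b₀ → (a ℤ.* b₀ ℤ.- a₀ ℤ.* b) ℤ.* (a ℤ.* b₀ ℤ.+ a₀ ℤ.* b)
                         ≡ a ℤ.* a ℤ.* (a₀ ℤ.* a₀ ℤ.+ b₀ ℤ.* b₀) ℤ.- a₀ ℤ.* a₀ ℤ.* (a ℤ.* a ℤ.+ b ℤ.* b)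
    expand = ℤ-Ring.solve-∀
    factor : ∀ x x₀ M → x ℤ.* M ℤ.- x₀ ℤ.* M ≡ (x ℤ.- x₀) ℤ.* M
    factor = ℤ-Ring.solve-∀
    +m≡ : ∀ {a b} → a * a + b * b ≡ m → + a ℤ.* + a ℤ.+ + b ℤ.* + b ≡ + m
    +m≡ {a} {b} rep = trans (sym (+-sumSq a b)) (cong +_ rep)
    det*perm≡ : det a b ℤ.* perm a b ≡ (+ a ℤ.* + a ℤ.- + a₀ ℤ.* + a₀) ℤ.* + m
    det*perm≡ = trans (expand (+ a) (+ b) (+ a₀) (+ b₀))
                  (trans (cong₂ (λ M₀ M → + a ℤ.* + a ℤ.* M₀ ℤ.- + a₀ ℤ.* + a₀ ℤ.* M)
                                (+m≡ {a₀} {b₀} rep₀) (+m≡ {a} {b} rep))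
                         (factor (+ a ℤ.* + a) (+ a₀ ℤ.* + a₀) (+ m)))

  b₀⊥m : Coprime b₀ m
  b₀⊥m = subst (Coprime b₀) rep₀ (coprime-sumSq a₀⊥b₀)

  ∣b₀*⇒∣ : ∀ {k} z → k ∣ m → k ∣ ∣ + b₀ ℤ.* z ∣ → k ∣ ∣ z ∣
  ∣b₀*⇒∣ {k} z k∣m k∣b₀z = coprime-divisor (coprime-∣ b₀⊥m k∣m) (subst (k ∣_) (ℤ.abs-* (+ b₀) z) k∣b₀z)

  ∣dets⇒∣ab'-a'b : ∀ {k a b a' b'} → k ∣ m → k ∣ ∣ det a b ∣ → k ∣ ∣ det a' b' ∣ →
                   k ∣ ∣ + a ℤ.* + b' ℤ.- + a' ℤ.* + b ∣
  ∣dets⇒∣ab'-a'b {k} {a} {b} {a'} {b'} k∣m k∣det k∣det' =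
    ∣b₀*⇒∣ (+ a ℤ.* + b' ℤ.- + a' ℤ.* + b) k∣m (subst (λ z → k ∣ ∣ z ∣) (eliminate (+ a) (+ b) (+ a') (+ b') (+ a₀) (+ b₀))
      (∣-linear-combination (det a b) (det a' b') (+ b') (+ b) k∣det k∣det'))
    where
    eliminate : ∀ a b a' b' a₀ b₀ → b' ℤ.* (a ℤ.* b₀ ℤ.- a₀ ℤ.* b) ℤ.- b ℤ.* (a' ℤ.* b₀ ℤ.- a₀ ℤ.* b')
                                  ≡ b₀ ℤ.* (a ℤ.* b' ℤ.- a' ℤ.* b)
    eliminate = ℤ-Ring.solve-∀

  ∣perms⇒∣ab'-a'b : ∀ {k a b a' b'} → k ∣ m → k ∣ ∣ perm a b ∣ → k ∣ ∣ perm a' b' ∣ →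
                    k ∣ ∣ + a ℤ.* + b' ℤ.- + a' ℤ.* + b ∣
  ∣perms⇒∣ab'-a'b {k} {a} {b} {a'} {b'} k∣m k∣perm k∣perm' =
    ∣b₀*⇒∣ (+ a ℤ.* + b' ℤ.- + a' ℤ.* + b) k∣m (subst (λ z → k ∣ ∣ z ∣) (eliminate (+ a) (+ b) (+ a') (+ b') (+ a₀) (+ b₀))
      (∣-linear-combination (perm a b) (perm a' b') (+ b') (+ b) k∣perm k∣perm'))
    where
    eliminate : ∀ a b a' b' a₀ b₀ → b' ℤ.* (a ℤ.* b₀ ℤ.+ a₀ ℤ.* b) ℤ.- b ℤ.* (a' ℤ.* b₀ ℤ.+ a₀ ℤ.* b')
                                  ≡ b₀ ℤ.* (a ℤ.* b' ℤ.- a' ℤ.* b)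
    eliminate = ℤ-Ring.solve-∀

  -- A common divisor of e and h divides det + perm = 2ab₀, hence divides 2; and 4 ∤ m.
  det-perm-coprime : ∀ {a b e h} → a * a + b * b ≡ m → Coprime a b → m ≡ e * h →
                     e ∣ ∣ det a b ∣ → h ∣ ∣ perm a b ∣ → Coprime e h
  det-perm-coprime {a} {b} {e} {h} rep a⊥b m≡e*h e∣det h∣perm {d} (d∣e , d∣h) =
    [ id , (λ d≡2 → ⊥-elim (¬2∣e∧h (subst (_∣ e) d≡2 d∣e) (subst (_∣ h) d≡2 d∣h))) ]′ (irreducible[2] d∣2)
    where
    d∣m : d ∣ m
    d∣m = subst (d ∣_) (sym m≡e*h) (∣m⇒∣m*n h d∣e)
    det+perm : ∀ a b a₀ b₀ → (a ℤ.* b₀ ℤ.- a₀ ℤ.* b) ℤ.+ (a ℤ.* b₀ ℤ.+ a₀ ℤ.* b) ≡ a ℤ.* (b₀ ℤ.* + 2)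
    det+perm = ℤ-Ring.solve-∀
    d∣a[b₀2] : d ∣ a * (b₀ * 2)
    d∣a[b₀2] = subst (d ∣_) (trans (ℤ.abs-* (+ a) (+ b₀ ℤ.* + 2)) (cong (a *_) (ℤ.abs-* (+ b₀) (+ 2))))
                 (subst (λ z → d ∣ ∣ z ∣) (det+perm (+ a) (+ b) (+ a₀) (+ b₀))
                   (ℤ∣.∣⇒∣ᵤ (ℤ∣.∣m∣n⇒∣m+n (ℤ∣.∣ᵤ⇒∣ {+ d} {det a b} (∣-trans d∣e e∣det))
                                          (ℤ∣.∣ᵤ⇒∣ {+ d} {perm a b} (∣-trans d∣h h∣perm)))))
    a⊥m : Coprime a m
    a⊥m = subst (Coprime a) (trans (+-comm (b * b) (a * a)) rep) (coprime-sumSq (Coprimality.sym a⊥b))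
    d∣2 : d ∣ 2
    d∣2 = coprime-divisor (coprime-∣ b₀⊥m d∣m) (coprime-divisor (coprime-∣ a⊥m d∣m) d∣a[b₀2])
    ¬2∣e∧h : 2 ∣ e → 2 ∣ h → ⊥
    ¬2∣e∧h 2∣e 2∣h = contradiction (a⊥b (4∣sumSq⇒even a b 4∣a²+b²)) λ ()
      where
      4∣a²+b² : 4 ∣ a * a + b * b
      4∣a²+b² = subst (4 ∣_) (trans (sym m≡e*h) (sym rep)) (*-pres-∣ 2∣e 2∣h)

  -- With e = gcd(m, det) and h = m/e, e divides both determinants and h both permanents.
  m∣ab'-a'b : ∀ {a b a' b'} → a * a + b * b ≡ m → a' * a' + b' * b' ≡ m → Coprime a b → 0 < a →
              gcd m ∣ det a b ∣ ≡ gcd m ∣ det a' b' ∣ → m ∣ ∣ + a ℤ.* + b' ℤ.- + a' ℤ.* + b ∣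
  m∣ab'-a'b {a} {b} {a'} {b'} rep rep' a⊥b 0<a same-gcd =
    subst (_∣ ∣ + a ℤ.* + b' ℤ.- + a' ℤ.* + b ∣) (sym m≡e*h)
      (coprime⇒*∣ (det-perm-coprime rep a⊥b m≡e*h e∣det h∣perm)
                  (∣dets⇒∣ab'-a'b {a = a} {b} {a'} {b'} e∣m e∣det e∣det')
                  (∣perms⇒∣ab'-a'b {a = a} {b} {a'} {b'} (divides e m≡e*h) h∣perm h∣perm'))
    where
    instance
      m≢0 : NonZero m
      m≢0 = >-nonZero (≤-trans (*-mono-≤ 0<a 0<a) (≤-trans (m≤m+n (a * a) (b * b)) (≤-reflexive rep)))
    e = gcd m ∣ det a b ∣
    e∣m : e ∣ m
    e∣m = gcd[m,n]∣m m ∣ det a b ∣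
    h = quotient e∣m
    m≡e*h : m ≡ e * h
    m≡e*h = m∣n⇒n≡m*quotient e∣m
    e∣det : e ∣ ∣ det a b ∣
    e∣det = gcd[m,n]∣n m ∣ det a b ∣
    e∣det' : e ∣ ∣ det a' b' ∣
    e∣det' = subst (_∣ ∣ det a' b' ∣) (sym same-gcd) (gcd[m,n]∣n m ∣ det a' b' ∣)
    h∣perm : h ∣ ∣ perm a b ∣
    h∣perm = ∣*⇒∣cofactor m≡e*h (m∣det*perm {a} {b} rep)
    h∣perm' : h ∣ ∣ perm a' b' ∣
    h∣perm' = ∣*⇒∣cofactor (trans m≡e*h (cong (_* h) same-gcd)) (m∣det*perm {a'} {b'} rep')

  det-gcd-injective : ∀ {a b a' b'} → a * a + b * b ≡ m → a' * a' + b' * b' ≡ m →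
    Coprime a b → Coprime a' b' → 0 < a → 0 < a' → gcd m ∣ det a b ∣ ≡ gcd m ∣ det a' b' ∣ → a ≡ a'
  det-gcd-injective {a} {b} {a'} {b'} rep rep' a⊥b a'⊥b' 0<a 0<a' same-gcd =
    coprime-ratio-injective a⊥b a'⊥b' (ℤ.+-injective (begin
      + (a * b')   ≡⟨ ℤ.pos-* a b' ⟩
      + a ℤ.* + b' ≡⟨ ℤ.i-j≡0⇒i≡j _ _ (ℤ.∣i∣≡0⇒i≡0 ∣t∣≡0) ⟩
      + a' ℤ.* + b ≡⟨ ℤ.pos-* a' b ⟨
      + (a' * b)   ∎))
    where
    open ≡-Reasoning
    ∣t∣≡0 : ∣ + a ℤ.* + b' ℤ.- + a' ℤ.* + b ∣ ≡ 0
    ∣t∣≡0 = ∣<⇒≡0 (m∣ab'-a'b {a} {b} {a'} {b'} rep rep' a⊥b 0<a same-gcd) (∣ab'-a'b∣<m rep rep' 0<a 0<a')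

r : ℕ → ℕ → ℕ
r d n = ∑[ x < d ] count d (λ y → x * x + y * y ≡ᵇ n)

primitive-part : ∀ {x y G} .{{_ : NonZero G}} → gcd x y ≡ G →
  Coprime (x / G) (y / G) × x ≡ x / G * G × y ≡ y / G * G
primitive-part {x} {y} {G} gcd≡G = GCD≡1⇒coprime (subst (GCD (x / G) (y / G)) (n/n≡1 G) gcd[x/G,y/G]) ,
                                   sym (m/n*n≡m G∣x) , sym (m/n*n≡m G∣y)
  where
  G∣x : G ∣ x
  G∣x = subst (_∣ x) gcd≡G (gcd[m,n]∣m x y)
  G∣y : G ∣ y
  G∣y = subst (_∣ y) gcd≡G (gcd[m,n]∣n x y)
  gcd[x/G,y/G] : GCD (x / G) (y / G) (G / G)
  gcd[x/G,y/G] = GCD-/ G∣x G∣y (∣-refl) (subst (GCD x y) gcd≡G (gcd-GCD x y))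

module Representations (d n : ℕ) where

  partner? : ∀ x → Dec (∃[ y ] (y < d × x * x + y * y ≡ n))
  partner? x = anyUpTo? (λ y → x * x + y * y ≟ n) d

  represented : ℕ → Bool
  represented x = ⌊ partner? x ⌋

  -- The y is unique; 0 when x is not represented.
  partner : ℕ → ℕ
  partner x with partner? x
  ... | yes (y , _) = y
  ... | no  _       = 0

  partner-rep : ∀ {x} → T (represented x) → x * x + partner x * partner x ≡ n
  partner-rep {x} h with partner? x
  ... | yes (_ , _ , rep) = rep

  r≤count-represented : r d n ≤ count d represented
  r≤count-represented = ∑-mono-≤ d λ x _ → count-≤-𝟙 d _ (represented x)
    (λ _ _ hy hy' → m*m≡n*n⇒m≡n (+-cancelˡ-≡ (x * x) _ _ (trans (≡ᵇ⇒≡ _ n hy) (sym (≡ᵇ⇒≡ _ n hy')))))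
    (λ {y} y<d hy → fromWitness (y , y<d , ≡ᵇ⇒≡ _ n hy))

  positive : ℕ → Bool
  positive x = represented x ∧ not (x ≡ᵇ 0)

  g : ℕ → ℕ
  g x = gcd x (partner x)

  positive⇒0< : ∀ {x} → T (positive x) → 0 < x
  positive⇒0< {zero}  h = ⊥-elim (proj₂ (T-∧⁻ h))
  positive⇒0< {suc x} h = z<s

  positive⇒rep : ∀ {x} → T (positive x) → x * x + partner x * partner x ≡ n
  positive⇒rep {x} h = partner-rep {x} (proj₁ (T-∧⁻ h))

  positive⇒n≢0 : ∀ {x} → T (positive x) → NonZero n
  positive⇒n≢0 {x} h = >-nonZero (subst (0 <_) (positive⇒rep {x} h)
    (≤-trans (*-mono-≤ (positive⇒0< {x} h) (positive⇒0< {x} h)) (m≤m+n (x * x) (partner x * partner x))))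

  scale : ∀ G a b → a * G * (a * G) + b * G * (b * G) ≡ G * G * (a * a + b * b)
  scale = ℕ-Ring.solve-∀

  -- The positively represented x with gcd(x, partner x) = G are determined by the primitive
  -- representations (x/G)² + (partner x/G)² of n/G², hence by a divisor of n.
  module GcdClass (G : ℕ) .{{_ : NonZero G}} where

    member : ℕ → Bool
    member x = positive x ∧ (g x ≡ᵇ G)

    a b : ℕ → ℕ
    a x = x / G
    b x = partner x / G

    module _ {x} (h : T (member x)) where

      member-positive : T (positive x)
      member-positive = proj₁ (T-∧⁻ h)

      member-primitive : Coprime (a x) (b x) × x ≡ a x * G × partner x ≡ b x * G
      member-primitive = primitive-part (≡ᵇ⇒≡ (g x) G (proj₂ (T-∧⁻ h)))

      member-rep : G * G * (a x * a x + b x * b x) ≡ n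
      member-rep = begin
        G * G * (a x * a x + b x * b x)               ≡⟨ scale G (a x) (b x) ⟨
        a x * G * (a x * G) + b x * G * (b x * G)     ≡⟨ cong₂ (λ u v → u * u + v * v) (sym (proj₁ (proj₂ member-primitive)))
                                                                                     (sym (proj₂ (proj₂ member-primitive))) ⟩
        x * x + partner x * partner x                 ≡⟨ positive⇒rep member-positive ⟩
        n                                             ∎
        where open ≡-Reasoning

      member-0<a : 0 < a x
      member-0<a with a x | proj₁ (proj₂ member-primitive) | positive⇒0< member-positive
      ... | zero  | x≡0 | 0<x = contradiction x≡0 (>⇒≢ 0<x)
      ... | suc _ | _   | _   = z<s

    module Anchored {x₀} (h₀ : T (member x₀)) where

      M : ℕ
      M = a x₀ * a x₀ + b x₀ * b x₀

      open PrimitiveRepresentations {M} {a x₀} {b x₀} refl (proj₁ (member-primitive {x₀} h₀))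

      rep-M : ∀ {x} → T (member x) → a x * a x + b x * b x ≡ M
      rep-M {x} h = *-cancelˡ-≡ _ _ (G * G) {{m*n≢0 G G}} (trans (member-rep {x} h) (sym (member-rep {x₀} h₀)))

      G∣n : G ∣ n
      G∣n = subst (G ∣_) (member-rep {x₀} h₀) (∣m⇒∣m*n M (m∣m*n G))

      count-member≤τ : count d member ≤ τ n
      count-member≤τ = count-≤-τ d n {{positive⇒n≢0 {x₀} (member-positive {x₀} h₀)}} member label
        (λ _ _ → ∣-trans (gcd[m,n]∣m M _) (divides (G * G) (sym (member-rep {x₀} h₀))))
        (λ {x} {x'} _ _ h h' same-label → begin
           x          ≡⟨ proj₁ (proj₂ (member-primitive {x} h)) ⟩
           a x * G    ≡⟨ cong (_* G) (det-gcd-injective (rep-M {x} h) (rep-M {x'} h') (proj₁ (member-primitive {x} h))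
                           (proj₁ (member-primitive {x'} h')) (member-0<a {x} h) (member-0<a {x'} h') same-label) ⟩
           a x' * G   ≡⟨ proj₁ (proj₂ (member-primitive {x'} h')) ⟨
           x'         ∎)
        where
        open ≡-Reasoning
        label : ℕ → ℕ
        label x = gcd M ∣ det (a x) (b x) ∣

  fibre≤ : ∀ G → count d (λ x → positive x ∧ (g x ≡ᵇ G)) ≤ 𝟙 ⌊ G ∣? n ⌋ * τ n
  fibre≤ zero = ≤-trans (≤-reflexive (count-≡0 d gcd≢0)) z≤n
    where
    gcd≢0 : ∀ {x} → x < d → T (positive x ∧ (g x ≡ᵇ 0)) → ⊥
    gcd≢0 {x} _ h with T-∧⁻ {positive x} h
    ... | x-positive , g≡0 = >⇒≢ (positive⇒0< x-positive) (gcd[m,n]≡0⇒m≡0 {x} {partner x} (≡ᵇ⇒≡ (g x) 0 g≡0))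
  fibre≤ G@(suc _) = count-≤-from-member d (GcdClass.member G) λ {x₀} _ h₀ → let open GcdClass.Anchored G {x₀} h₀ in begin
    count d (GcdClass.member G) ≤⟨ count-member≤τ ⟩
    τ n                      ≡⟨ *-identityˡ (τ n) ⟨
    1 * τ n                  ≡⟨ cong (_* τ n) (T⇒𝟙≡1 (fromWitness {a? = G ∣? n} G∣n)) ⟨
    𝟙 ⌊ G ∣? n ⌋ * τ n       ∎
    where open ≤-Reasoning

  count-positive≤τ² : count d positive ≤ τ n * τ n
  count-positive≤τ² = begin
    count d positive                                   ≤⟨ count-≤-fibres d (suc n) positive g g≤n ⟩
    ∑[ G < suc n ] count d (λ x → positive x ∧ (g x ≡ᵇ G)) ≤⟨ ∑-mono-≤ (suc n) (λ G _ → fibre≤ G) ⟩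
    ∑[ G < suc n ] (𝟙 ⌊ G ∣? n ⌋ * τ n)                ≡⟨ ∑-*ʳ (suc n) (τ n) _ ⟩
    τ n * τ n                                          ∎
    where
    open ≤-Reasoning
    g≤n : ∀ {x} → x < d → T (positive x) → g x < suc n
    g≤n {x} _ h = s≤s (begin
      g x                          ≤⟨ ∣⇒≤ {{>-nonZero (positive⇒0< h)}} (gcd[m,n]∣m x (partner x)) ⟩
      x                            ≤⟨ m≤m*n x x {{>-nonZero (positive⇒0< h)}} ⟩
      x * x                        ≤⟨ m≤m+n (x * x) _ ⟩
      x * x + partner x * partner x ≡⟨ positive⇒rep h ⟩
      n                            ∎)

  r≤τ²+1 : r d n ≤ τ n * τ n + 1
  r≤τ²+1 = begin
    r d n                ≤⟨ r≤count-represented ⟩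
    count d represented  ≡⟨ count-split d represented (_≡ᵇ 0) ⟩
    count d positive + count d (λ x → represented x ∧ (x ≡ᵇ 0))
                         ≤⟨ +-mono-≤ count-positive≤τ²
                              (count-≤-1 d _ λ _ _ hx hy → trans (x≡0 hx) (sym (x≡0 hy))) ⟩
    τ n * τ n + 1        ∎
    where
    open ≤-Reasoning
    x≡0 : ∀ {x} → T (represented x ∧ (x ≡ᵇ 0)) → x ≡ 0
    x≡0 {x} h = ≡ᵇ⇒≡ x 0 (proj₂ (T-∧⁻ {represented x} h))

r-growth : ∀ k → ∃[ C ] (∀ d n → n < d * d + d * d → r d n ^ k ≤ C * d)
r-growth k with divisor-bound (4 * k)
... | Cτ , τ^4k≤ = C , bound
  where
  C = 4 ^ k * Cτ * 2
  square : ∀ t → 2 * (t * t) * (2 * (t * t)) ≡ 4 * (t * (t * (t * (t * 1))))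
  square = ℕ-Ring.solve-∀
  rearrange : ∀ a c m → a * (c * (m + m)) ≡ a * c * 2 * m
  rearrange = ℕ-Ring.solve-∀
  bound : ∀ d n → n < d * d + d * d → r d n ^ k ≤ C * d
  bound d n n<N = m*m≤n*n⇒m≤n (begin
    r d n ^ k * r d n ^ k                         ≡⟨ ^-distribʳ-* (r d n) (r d n) k ⟨
    (r d n * r d n) ^ k                           ≤⟨ ^-monoˡ-≤ k (*-mono-≤ r≤2t² r≤2t²) ⟩
    (2 * (t * t) * (2 * (t * t))) ^ k             ≡⟨ cong (_^ k) (square t) ⟩
    (4 * t ^ 4) ^ k                               ≡⟨ ^-distribʳ-* 4 (t ^ 4) k ⟩
    4 ^ k * (t ^ 4) ^ k                           ≡⟨ cong (4 ^ k *_) (^-*-assoc t 4 k) ⟩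
    4 ^ k * t ^ (4 * k)                           ≤⟨ *-monoʳ-≤ (4 ^ k) (τ^4k≤ n) ⟩
    4 ^ k * (Cτ * suc n)                          ≤⟨ *-monoʳ-≤ (4 ^ k) (*-monoʳ-≤ Cτ n<N) ⟩
    4 ^ k * (Cτ * (d * d + d * d))                ≡⟨ rearrange (4 ^ k) Cτ (d * d) ⟩
    C * (d * d)                                   ≤⟨ *-monoˡ-≤ (d * d) (n≤n*n C) ⟩
    C * C * (d * d)                               ≡⟨ *-interchange C C d d ⟩
    C * d * (C * d)                               ∎)
    where
    open ≤-Reasoning
    t = τ n
    r≤2t² : r d n ≤ 2 * (t * t)
    r≤2t² = ≤-trans (Representations.r≤τ²+1 d n)
                    (≤-trans (+-monoʳ-≤ (t * t) (*-mono-≤ (1≤τ n) (1≤τ n)))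
                             (≤-reflexive (cong (λ u → t * t + u) (sym (+-identityʳ (t * t))))))

-- The system modulo d

i≡±∣i∣ : ∀ i → i ≡ + ∣ i ∣ ⊎ i ≡ ℤ.- + ∣ i ∣
i≡±∣i∣ (+ n)      = inj₁ refl
i≡±∣i∣ ℤ.-[1+ n ] = inj₂ refl

-- The values Δn − c (n < N) are distinct multiples of d in (−dB, dB), and there are at most 2B of those.
count-congruent≤ : ∀ d N B (Δ c : ℤ) .{{_ : NonZero d}} → Δ ≢ 0ℤ →
  (∀ {n} → n < N → ∣ Δ ℤ.* + n ℤ.- c ∣ < d * B) →
  count N (λ n → divides? d (Δ ℤ.* + n ℤ.- c)) ≤ B * 2
count-congruent≤ d N B Δ c Δ≢0 bounded = begin
  count N P                                   ≤⟨ count-≤-fibres N B P f f<B ⟩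
  ∑[ y < B ] count N (λ n → P n ∧ (f n ≡ᵇ y)) ≤⟨ ∑-≤-* B 2 (λ y _ → fibre≤2 y) ⟩
  B * 2                                       ∎
  where
  open ≤-Reasoning
  z : ℕ → ℤ
  z n = Δ ℤ.* + n ℤ.- c
  P : ℕ → Bool
  P n = divides? d (z n)
  f : ℕ → ℕ
  f n = ∣ z n ∣ / d
  f<B : ∀ {n} → n < N → T (P n) → f n < B
  f<B {n} n<N _ = m<n*o⇒m/o<n (subst (∣ z n ∣ <_) (*-comm d B) (bounded n<N))
  z-injective : ∀ {n n'} → z n ≡ z n' → n ≡ n'
  z-injective {n} {n'} eq = ℤ.+-injective (ℤ.*-cancelˡ-≡ Δ (+ n) (+ n') {{ℤ.≢-nonZero Δ≢0}}
    (trans (sym (undo (Δ ℤ.* + n) c)) (trans (cong (ℤ._+ c) eq) (undo (Δ ℤ.* + n') c))))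
    where
    undo : ∀ i c → i ℤ.- c ℤ.+ c ≡ i
    undo = ℤ-Ring.solve-∀
  fibre≤2 : ∀ y → count N (λ n → P n ∧ (f n ≡ᵇ y)) ≤ 2
  fibre≤2 y = begin
    count N (λ n → P n ∧ (f n ≡ᵇ y))  ≤⟨ count-mono-≤ N ± ⟩
    count N (λ n → is (+ (y * d)) n ∨ is (ℤ.- + (y * d)) n)
                                      ≤⟨ count-∨-≤ N _ _ ⟩
    count N (is (+ (y * d))) + count N (is (ℤ.- + (y * d)))
                                      ≤⟨ +-mono-≤ (at-most-one (+ (y * d))) (at-most-one (ℤ.- + (y * d))) ⟩
    2                                 ∎
    where
    is : ℤ → ℕ → Bool
    is w n = ⌊ z n ℤ.≟ w ⌋
    at-most-one : ∀ w → count N (is w) ≤ 1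
    at-most-one w = count-≤-1 N (is w) λ _ _ hn hn' → z-injective (trans (toWitness hn) (sym (toWitness hn')))
    ∣z∣≡yd : ∀ {n} → T (P n ∧ (f n ≡ᵇ y)) → ∣ z n ∣ ≡ y * d
    ∣z∣≡yd {n} h with T-∧⁻ {P n} h
    ... | d∣zn , fn≡y = trans (sym (m/n*n≡m (toWitness {a? = d ∣? ∣ z n ∣} d∣zn))) (cong (_* d) (≡ᵇ⇒≡ (f n) y fn≡y))
    ± : ∀ {n} → n < N → T (P n ∧ (f n ≡ᵇ y)) → T (is (+ (y * d)) n ∨ is (ℤ.- + (y * d)) n)
    ± {n} _ h with i≡±∣i∣ (z n)
    ... | inj₁ eq = Equivalence.from T-∨ (inj₁ (fromWitness {a? = z n ℤ.≟ + (y * d)} (trans eq (cong +_ (∣z∣≡yd {n} h)))))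
    ... | inj₂ eq = Equivalence.from T-∨
                      (inj₂ (fromWitness {a? = z n ℤ.≟ ℤ.- + (y * d)} (trans eq (cong (ℤ.-_ ∘ +_) (∣z∣≡yd {n} h)))))

∑∑-sumSq≤ : ∀ d N (h : ℕ → ℕ) → (∀ {x y} → x < d → y < d → x * x + y * y < N) →
  ∑[ x < d ] ∑[ y < d ] h (x * x + y * y) ≤ ∑[ n < N ] (h n * r d n)
∑∑-sumSq≤ d N h sumSq<N = begin
  ∑[ x < d ] ∑[ y < d ] h (x * x + y * y)
                                                          ≤⟨ ∑-mono-≤ d (λ x x<d → ∑-mono-≤ d (λ y y<d → split x<d y<d)) ⟩
  ∑[ x < d ] ∑[ y < d ] ∑[ n < N ] (h n * 𝟙 (x * x + y * y ≡ᵇ n)) ≡⟨ ∑-cong d (λ x _ → ∑-comm d N _) ⟩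
  ∑[ x < d ] ∑[ n < N ] ∑[ y < d ] (h n * 𝟙 (x * x + y * y ≡ᵇ n)) ≡⟨ ∑-comm d N _ ⟩
  ∑[ n < N ] ∑[ x < d ] ∑[ y < d ] (h n * 𝟙 (x * x + y * y ≡ᵇ n)) ≡⟨ ∑-cong N (λ n _ → factor n) ⟩
  ∑[ n < N ] (h n * r d n)                                      ∎
  where
  open ≤-Reasoning
  split : ∀ {x y} → x < d → y < d → h (x * x + y * y) ≤ ∑[ n < N ] (h n * 𝟙 (x * x + y * y ≡ᵇ n))
  split {x} {y} x<d y<d = begin
    h s                   ≡⟨ *-identityʳ (h s) ⟨
    h s * 1               ≡⟨ cong (h s *_) (T⇒𝟙≡1 (≡⇒≡ᵇ s s refl)) ⟨
    h s * 𝟙 (s ≡ᵇ s)      ≤⟨ term≤∑ N (λ n → h n * 𝟙 (s ≡ᵇ n)) (sumSq<N x<d y<d) ⟩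
    ∑[ n < N ] (h n * 𝟙 (s ≡ᵇ n)) ∎
    where s = x * x + y * y
  factor : ∀ n → ∑[ x < d ] ∑[ y < d ] (h n * 𝟙 (x * x + y * y ≡ᵇ n)) ≡ h n * r d n
  factor n = trans (∑-cong d (λ x _ → ∑-*ˡ d (h n) _)) (∑-*ˡ d (h n) _)

eliminate₃₄ : ∀ (α α' β β' β'' X Y Z : ℤ) →
  β' ℤ.* (α ℤ.* X ℤ.+ α' ℤ.* Y) ℤ.- α' ℤ.* (β ℤ.* X ℤ.+ β' ℤ.* Y ℤ.+ β'' ℤ.* Z)
    ≡ (α ℤ.* β' ℤ.- α' ℤ.* β) ℤ.* X ℤ.- α' ℤ.* β'' ℤ.* Z
eliminate₃₄ = ℤ-Ring.solve-∀

eliminate₁₂ : ∀ (α α' β β' β'' X Y Z : ℤ) →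
  α ℤ.* (β ℤ.* X ℤ.+ β' ℤ.* Y ℤ.+ β'' ℤ.* Z) ℤ.- β ℤ.* (α ℤ.* X ℤ.+ α' ℤ.* Y)
    ≡ (α ℤ.* β' ℤ.- α' ℤ.* β) ℤ.* Y ℤ.- ℤ.- (α ℤ.* β'' ℤ.* Z)
eliminate₁₂ = ℤ-Ring.solve-∀

module System (α α' β β' β'' : ℤ) where

  Δ : ℤ
  Δ = α ℤ.* β' ℤ.- α' ℤ.* β

  κ L : ℕ
  κ = ∣ Δ ∣ + ∣ α' ∣ * ∣ β'' ∣ + ∣ α ∣ * ∣ β'' ∣
  L = κ * 2 + 1

  c₁ c₂ : ℕ → ℕ → ℤ
  c₁ k₅ k₆ = α' ℤ.* β'' ℤ.* + (k₅ * k₅ + k₆ * k₆)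
  c₂ k₅ k₆ = ℤ.- (α ℤ.* β'' ℤ.* + (k₅ * k₅ + k₆ * k₆))

  module _ (d : ℕ) .{{_ : NonZero d}} where
    solutions : ℤ → ℕ → ℕ → Bool
    solutions c x y = divides? d (Δ ℤ.* + (x * x + y * y) ℤ.- c)

    #solutions : ℤ → ℕ
    #solutions c = ∑[ x < d ] count d (solutions c x)

    system : ℕ → ℕ → ℕ → ℕ → ℕ → ℕ → Bool
    system k₁ k₂ k₃ k₄ k₅ k₆ = divides? d (Q₁ α α' (+ k₁) (+ k₂) (+ k₃) (+ k₄) (+ k₅) (+ k₆))
                               ∧ divides? d (Q₂ β β' β'' (+ k₁) (+ k₂) (+ k₃) (+ k₄) (+ k₅) (+ k₆))

    combination-divisible : ∀ {x y w} c c' → d ∣ ∣ x ∣ → d ∣ ∣ y ∣ → c ℤ.* x ℤ.- c' ℤ.* y ≡ w →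
                            T (divides? d w)
    combination-divisible {x} {y} c c' d∣x d∣y eq =
      fromWitness (subst (λ w → d ∣ ∣ w ∣) eq (∣-linear-combination x y c c' d∣x d∣y))

    system⇒solutions : ∀ k₁ k₂ k₃ k₄ k₅ k₆ → T (system k₁ k₂ k₃ k₄ k₅ k₆) →
                       T (solutions (c₁ k₅ k₆) k₁ k₂ ∧ solutions (c₂ k₅ k₆) k₃ k₄)
    system⇒solutions k₁ k₂ k₃ k₄ k₅ k₆ h with T-∧⁻ {divides? d q₁} h
      where
      q₁ = Q₁ α α' (+ k₁) (+ k₂) (+ k₃) (+ k₄) (+ k₅) (+ k₆)
    ... | d∣Q₁ , d∣Q₂ = Equivalence.from T-∧
      ( combination-divisible β' α' (toWitness d∣Q₁) (toWitness d∣Q₂)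
          (trans (eliminate₃₄ α α' β β' β'' X Y Z) (cong₂ (λ u v → Δ ℤ.* u ℤ.- α' ℤ.* β'' ℤ.* v) X≡ Z≡))
      , combination-divisible α β (toWitness d∣Q₂) (toWitness d∣Q₁)
          (trans (eliminate₁₂ α α' β β' β'' X Y Z) (cong₂ (λ u v → Δ ℤ.* u ℤ.- ℤ.- (α ℤ.* β'' ℤ.* v)) Y≡ Z≡)) )
      where
      X = sq (+ k₁) ℤ.+ sq (+ k₂)
      Y = sq (+ k₃) ℤ.+ sq (+ k₄)
      Z = sq (+ k₅) ℤ.+ sq (+ k₆)
      X≡ : X ≡ + (k₁ * k₁ + k₂ * k₂)
      X≡ = sym (+-sumSq k₁ k₂)
      Y≡ : Y ≡ + (k₃ * k₃ + k₄ * k₄)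
      Y≡ = sym (+-sumSq k₃ k₄)
      Z≡ : Z ≡ + (k₅ * k₅ + k₆ * k₆)
      Z≡ = sym (+-sumSq k₅ k₆)

    ρ≤∑#solutions² :
      ρ α α' β β' β'' d ≤ ∑[ k₅ < d ] ∑[ k₆ < d ] (#solutions (c₁ k₅ k₆) * #solutions (c₂ k₅ k₆))
    ρ≤∑#solutions² = begin
      ρ α α' β β' β'' d
        ≡⟨ Σres≗∑ (λ _ → Σres≗∑ (λ _ → Σres≗∑ (λ _ → Σres≗∑ (λ _ → Σres≗∑ (λ _ → Σres≗∑ (λ _ → refl)))))) ⟩
      ∑[ k₁ < d ] ∑[ k₂ < d ] ∑[ k₃ < d ] ∑[ k₄ < d ] ∑[ k₅ < d ] ∑[ k₆ < d ] 𝟙 (system k₁ k₂ k₃ k₄ k₅ k₆)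
        ≤⟨ ∑-mono-≤ d (λ k₁ _ → ∑-mono-≤ d (λ k₂ _ → ∑-mono-≤ d (λ k₃ _ → ∑-mono-≤ d (λ k₄ _ →
             ∑-mono-≤ d (λ k₅ _ → ∑-mono-≤ d (λ k₆ _ → split k₁ k₂ k₃ k₄ k₅ k₆)))))) ⟩
      ∑[ k₁ < d ] ∑[ k₂ < d ] ∑[ k₃ < d ] ∑[ k₄ < d ] ∑[ k₅ < d ] ∑[ k₆ < d ] H k₁ k₂ k₃ k₄ k₅ k₆
        ≡⟨ ∑-cong d (λ k₁ _ → ∑-cong d (λ k₂ _ → ∑-swap₂ d d (H k₁ k₂))) ⟩
      ∑[ k₁ < d ] ∑[ k₂ < d ] ∑[ k₅ < d ] ∑[ k₆ < d ] ∑[ k₃ < d ] ∑[ k₄ < d ] H k₁ k₂ k₃ k₄ k₅ k₆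
        ≡⟨ ∑-swap₂ d d (λ k₁ k₂ k₅ k₆ → ∑[ k₃ < d ] ∑[ k₄ < d ] H k₁ k₂ k₃ k₄ k₅ k₆) ⟩
      ∑[ k₅ < d ] ∑[ k₆ < d ] ∑[ k₁ < d ] ∑[ k₂ < d ] ∑[ k₃ < d ] ∑[ k₄ < d ] H k₁ k₂ k₃ k₄ k₅ k₆
        ≡⟨ ∑-cong d (λ k₅ _ → ∑-cong d (λ k₆ _ →
             ∑₂-product d (λ k₁ k₂ → 𝟙 (solutions (c₁ k₅ k₆) k₁ k₂)) (λ k₃ k₄ → 𝟙 (solutions (c₂ k₅ k₆) k₃ k₄)))) ⟩
      ∑[ k₅ < d ] ∑[ k₆ < d ] (#solutions (c₁ k₅ k₆) * #solutions (c₂ k₅ k₆)) ∎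
      where
      open ≤-Reasoning
      Σres≗∑ : ∀ {f g : ℕ → ℕ} → (∀ x → f x ≡ g x) → Σres d f ≡ ∑ d g
      Σres≗∑ {f} f≗g = trans (Σres≡∑ d f) (∑-cong d (λ x _ → f≗g x))
      H : ℕ → ℕ → ℕ → ℕ → ℕ → ℕ → ℕ
      H k₁ k₂ k₃ k₄ k₅ k₆ = 𝟙 (solutions (c₁ k₅ k₆) k₁ k₂) * 𝟙 (solutions (c₂ k₅ k₆) k₃ k₄)
      split : ∀ k₁ k₂ k₃ k₄ k₅ k₆ → 𝟙 (system k₁ k₂ k₃ k₄ k₅ k₆) ≤ H k₁ k₂ k₃ k₄ k₅ k₆
      split k₁ k₂ k₃ k₄ k₅ k₆ = ≤-trans (𝟙-mono-≤ (system⇒solutions k₁ k₂ k₃ k₄ k₅ k₆))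
                                        (≤-reflexive (𝟙-∧ (solutions (c₁ k₅ k₆) k₁ k₂) (solutions (c₂ k₅ k₆) k₃ k₄)))

    N : ℕ
    N = d * d + d * d

    sumSq<N : ∀ {x y} → x < d → y < d → x * x + y * y < N
    sumSq<N x<d y<d = +-mono-<-≤ (*-mono-< x<d x<d) (<⇒≤ (*-mono-< y<d y<d))

    ∣Δn-c∣< : ∀ {n a} c → n < N → ∣ c ∣ ≤ a * N → ∣ Δ ∣ + a ≤ κ → ∣ Δ ℤ.* + n ℤ.- c ∣ < d * (L * d)
    ∣Δn-c∣< {n} {a} c n<N ∣c∣≤aN ∣Δ∣+a≤κ = begin-strict
      ∣ Δ ℤ.* + n ℤ.- c ∣        ≤⟨ ℤ.∣i-j∣≤∣i∣+∣j∣ (Δ ℤ.* + n) c ⟩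
      ∣ Δ ℤ.* + n ∣ + ∣ c ∣      ≡⟨ cong (_+ ∣ c ∣) (ℤ.abs-* Δ (+ n)) ⟩
      ∣ Δ ∣ * n + ∣ c ∣          ≤⟨ +-mono-≤ (*-monoʳ-≤ ∣ Δ ∣ (<⇒≤ n<N)) ∣c∣≤aN ⟩
      ∣ Δ ∣ * N + a * N          ≡⟨ *-distribʳ-+ N ∣ Δ ∣ a ⟨
      (∣ Δ ∣ + a) * N            ≤⟨ *-monoˡ-≤ N ∣Δ∣+a≤κ ⟩
      κ * N                      <⟨ m<m+n (κ * N) (>-nonZero⁻¹ (d * d) {{m*n≢0 d d}}) ⟩
      κ * N + d * d              ≡⟨ expand κ d ⟩
      d * (L * d)                ∎
      where
      open ≤-Reasoning
      expand : ∀ κ d → κ * (d * d + d * d) + d * d ≡ d * ((κ * 2 + 1) * d)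
      expand = ℕ-Ring.solve-∀

    ∣coefficient*sumSq∣≤ : ∀ γ {k₅ k₆} → k₅ < d → k₆ < d → ∣ γ ℤ.* + (k₅ * k₅ + k₆ * k₆) ∣ ≤ ∣ γ ∣ * N
    ∣coefficient*sumSq∣≤ γ k₅<d k₆<d =
      ≤-trans (≤-reflexive (ℤ.abs-* γ _)) (*-monoʳ-≤ ∣ γ ∣ (<⇒≤ (sumSq<N k₅<d k₆<d)))

    module _ (Δ≢0 : Δ ≢ 0ℤ) (W : ℕ) (r≤W : ∀ {n} → n < N → r d n ≤ W) where

      #solutions≤ : ∀ c {a} → ∣ c ∣ ≤ a * N → ∣ Δ ∣ + a ≤ κ → #solutions c ≤ L * d * 2 * W
      #solutions≤ c ∣c∣≤aN ∣Δ∣+a≤κ = begin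
        #solutions c                             ≤⟨ ∑∑-sumSq≤ d N (𝟙 ∘ P) sumSq<N ⟩
        ∑[ n < N ] (𝟙 (P n) * r d n)    ≤⟨ ∑-mono-≤ N (λ n n<N → *-monoʳ-≤ (𝟙 (P n)) (r≤W n<N)) ⟩
        ∑[ n < N ] (𝟙 (P n) * W)        ≡⟨ ∑-*ʳ N W (𝟙 ∘ P) ⟩
        count N P * W                   ≤⟨ *-monoˡ-≤ W (count-congruent≤ d N (L * d) Δ c Δ≢0
                                             (λ n<N → ∣Δn-c∣< c n<N ∣c∣≤aN ∣Δ∣+a≤κ)) ⟩
        L * d * 2 * W                   ∎
        where
        open ≤-Reasoning
        P : ℕ → Bool
        P n = divides? d (Δ ℤ.* + n ℤ.- c)

      ρ≤ : ρ α α' β β' β'' d ≤ d * (d * ((L * d * 2 * W) * (L * d * 2 * W)))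
      ρ≤ = ≤-trans ρ≤∑#solutions² (∑-≤-* d _ λ k₅ k₅<d → ∑-≤-* d _ λ k₆ k₆<d →
             *-mono-≤ (#solutions≤ (c₁ k₅ k₆) (∣c₁∣≤ k₅<d k₆<d) (m≤m+n (∣ Δ ∣ + ∣ α' ∣ * ∣ β'' ∣) (∣ α ∣ * ∣ β'' ∣)))
                      (#solutions≤ (c₂ k₅ k₆) (∣c₂∣≤ k₅<d k₆<d) (+-monoˡ-≤ (∣ α ∣ * ∣ β'' ∣) (m≤m+n ∣ Δ ∣ (∣ α' ∣ * ∣ β'' ∣)))))
        where
        ∣c₁∣≤ : ∀ {k₅ k₆} → k₅ < d → k₆ < d → ∣ c₁ k₅ k₆ ∣ ≤ ∣ α' ∣ * ∣ β'' ∣ * N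
        ∣c₁∣≤ k₅<d k₆<d = ≤-trans (∣coefficient*sumSq∣≤ (α' ℤ.* β'') k₅<d k₆<d)
                                  (≤-reflexive (cong (_* N) (ℤ.abs-* α' β'')))
        ∣c₂∣≤ : ∀ {k₅ k₆} → k₅ < d → k₆ < d → ∣ c₂ k₅ k₆ ∣ ≤ ∣ α ∣ * ∣ β'' ∣ * N
        ∣c₂∣≤ {k₅} {k₆} k₅<d k₆<d = ≤-trans (≤-reflexive (ℤ.∣-i∣≡∣i∣ (α ℤ.* β'' ℤ.* + (k₅ * k₅ + k₆ * k₆))))
          (≤-trans (∣coefficient*sumSq∣≤ (α ℤ.* β'') k₅<d k₆<d) (≤-reflexive (cong (_* N) (ℤ.abs-* α β''))))

power-bound : ∀ {x d W C} L Q p → x ≤ d * (d * (L * d * 2 * W * (L * d * 2 * W))) → W ^ (Q + Q) ≤ C * d →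
  x ^ Q ≤ (L * 2 * (L * 2)) ^ Q * C * d ^ (4 * Q + suc p)
power-bound {x} {d} {W} {C} L Q p x≤ W^2Q≤ = begin
  x ^ Q                                       ≤⟨ ^-monoˡ-≤ Q x≤ ⟩
  (d * (d * (L * d * 2 * W * (L * d * 2 * W)))) ^ Q ≡⟨ cong (_^ Q) (regroup L d W) ⟩
  (a * d ^ 4 * (W * W)) ^ Q                   ≡⟨ ^-distribʳ-* (a * d ^ 4) (W * W) Q ⟩
  (a * d ^ 4) ^ Q * (W * W) ^ Q               ≡⟨ cong₂ _*_ (^-distribʳ-* a (d ^ 4) Q)
                                                   (trans (^-distribʳ-* W W Q) (sym (^-distribˡ-+-* W Q Q))) ⟩
  a ^ Q * (d ^ 4) ^ Q * W ^ (Q + Q)           ≤⟨ *-monoʳ-≤ (a ^ Q * (d ^ 4) ^ Q) W^2Q≤ ⟩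
  a ^ Q * (d ^ 4) ^ Q * (C * d)               ≡⟨ cong (λ e → a ^ Q * e * (C * d)) (^-*-assoc d 4 Q) ⟩
  a ^ Q * d ^ (4 * Q) * (C * d)               ≡⟨ rearrange (a ^ Q) (d ^ (4 * Q)) C d ⟩
  a ^ Q * C * (d ^ (4 * Q) * d)               ≤⟨ *-monoʳ-≤ (a ^ Q * C) (*-monoʳ-≤ (d ^ (4 * Q)) (n≤n^[1+m] d p)) ⟩
  a ^ Q * C * (d ^ (4 * Q) * d ^ suc p)       ≡⟨ cong (a ^ Q * C *_) (^-distribˡ-+-* d (4 * Q) (suc p)) ⟨
  a ^ Q * C * d ^ (4 * Q + suc p)             ∎
  where
  open ≤-Reasoning
  a = L * 2 * (L * 2)
  regroup : ∀ L d W → d * (d * (L * d * 2 * W * (L * d * 2 * W))) ≡ L * 2 * (L * 2) * (d * (d * (d * (d * 1)))) * (W * W)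
  regroup = ℕ-Ring.solve-∀
  rearrange : ∀ a e C d → a * e * (C * d) ≡ a * C * (e * d)
  rearrange = ℕ-Ring.solve-∀

lemma2 : (α α' β β' β'' : ℤ) →
    α ≢ 0ℤ → α' ≢ 0ℤ → β ≢ 0ℤ → β' ≢ 0ℤ → β'' ≢ 0ℤ →
    α ℤ.* β' ℤ.- α' ℤ.* β ≢ 0ℤ →
    (p q : ℕ) → ∃[ C ] ((d : ℕ) →
      ρ α α' β β' β'' (suc d) ^ suc q ≤ C * (suc d) ^ (4 * suc q + suc p))
lemma2 α α' β β' β'' _ _ _ _ _ Δ≢0 p q = (L * 2 * (L * 2)) ^ suc q * C , bound
  where
  open System α α' β β' β''
  C = proj₁ (r-growth (suc q + suc q))
  bound : ∀ d → ρ α α' β β' β'' (suc d) ^ suc q ≤ (L * 2 * (L * 2)) ^ suc q * C * suc d ^ (4 * suc q + suc p)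
  bound d = power-bound {ρ α α' β β' β'' (suc d)} {suc d} {r (suc d) n₀} {C} L (suc q) p
              (ρ≤ (suc d) Δ≢0 (r (suc d) n₀) (proj₂ (proj₂ max)))
              (proj₂ (r-growth (suc q + suc q)) (suc d) n₀ (proj₁ (proj₂ max)))
    where
    max = argmax (N (suc d)) (r (suc d)) z<s
    n₀ = proj₁ max
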